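{- Let $q$ be a prime power with $q \equiv 3 \pmod 4$, and let $E \subset \mathbb{F}_q^2$. If $|E| \geq \sqrt{2}\,q$, then for each $r \in \mathbb{F}_q^*$, \[ V(r) \geq \frac{|E|^4}{4q}, \] where $V(r) = \#\left\{(a,b,c,d) \in E^4 : \|c-d\|^2 \neq 0,\ \frac{\|a-b\|^2}{\|c-d\|^2} = r\right\}$.
   Context: $\mathbb{F}_q$ is the finite field with $q$ elements and $\mathbb{F}_q^* = \mathbb{F}_q \setminus \{0\}$. For $x=(x_1,x_2) \in \mathbb{F}_q^2$, $\|x\|^2 := x_1^2 + x_2^2$. -}

module Defs where

open import Data.Nat using (ℕ; suc; _^_; _%_)
open import Data.Nat.Primality using (Prime)
open import Data.Fin using (Fin)
open import Data.Bool using (Bool; true)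
open import Data.Product using (_×_; _,_; ∃-syntax)
open import Data.List using (List; map; filter; length; allFin; cartesianProduct; concatMap)
open import Function.Bundles using (_↔_; Inverse)
open import Algebra.Structures using (IsCommutativeRing)
open import Relation.Binary.PropositionalEquality using (_≡_; _≢_)
open import Relation.Binary.Definitions using (DecidableEquality)
open import Relation.Nullary using (Dec; yes; no; ¬_)
open import Relation.Nullary.Decidable using (_×-dec_; ¬?)

IsPrimePower : ℕ → Set
IsPrimePower q = ∃[ p ] ∃[ k ] (Prime p × q ≡ p ^ suc k)

record FiniteField (q : ℕ) : Set₁ where
  infixl 6 _+_ _-_
  infixl 7 _*_
  field
    Carrier : Set
    _+_ _*_ : Carrier → Carrier → Carrier
    -_ : Carrier → Carrier
    0# 1# : Carrier
    isCommutativeRing : IsCommutativeRing _≡_ _+_ _*_ -_ 0# 1#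
    0≢1 : 0# ≢ 1#
    _⁻¹ : Carrier → Carrier
    inverse : ∀ x → x ≢ 0# → x * (x ⁻¹) ≡ 1#
    _≟_ : DecidableEquality Carrier
    enum : Fin q ↔ Carrier

  _-_ : Carrier → Carrier → Carrier
  x - y = x + (- y)

  -- division (only meaningful for nonzero denominators)
  _/_ : Carrier → Carrier → Carrier
  x / y = x * (y ⁻¹)

  Point : Set
  Point = Carrier × Carrier

  _-ᵖ_ : Point → Point → Point
  (x₁ , x₂) -ᵖ (y₁ , y₂) = (x₁ - y₁ , x₂ - y₂)

  ‖_‖² : Point → Carrier
  ‖ (x₁ , x₂) ‖² = x₁ * x₁ + x₂ * x₂

  elements : List Carrier
  elements = map (Inverse.to enum) (allFin q)

  points : List Point
  points = cartesianProduct elements elements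

  pointsOf : (Point → Bool) → List Point
  pointsOf E = filter (λ x → E x Data.Bool.≟ true) points

  card : (Point → Bool) → ℕ
  card E = length (pointsOf E)

  quadruples : (Point → Bool) → List (Point × Point × Point × Point)
  quadruples E =
    concatMap (λ a → concatMap (λ b → concatMap (λ c → map (λ d → (a , b , c , d))
      (pointsOf E)) (pointsOf E)) (pointsOf E)) (pointsOf E)

  V : (Point → Bool) → Carrier → ℕ
  V E r = length (filter
    (λ { (a , b , c , d) →
         ¬? (‖ c -ᵖ d ‖² ≟ 0#) ×-dec ((‖ a -ᵖ b ‖² / ‖ c -ᵖ d ‖²) ≟ r) })
    (quadruples E))

module Submission where

-- Since q ≡ 3 (mod 4), 2 ≠ 0 and −1 is not a square in F_q: otherwise the involution x ↦ x + 1
-- would force 2 ∣ q, and y ↦ −y, which preserves the (even) number of square roots of y ≠ 0,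
-- would force 4 ∣ q − 1. So F_q² is the field F_q(i), whose norm ‖x‖² = x₁² + x₂² is
-- multiplicative and vanishes only at 0. Writing r = ‖s‖² (every element is a sum of two
-- squares) and parametrising the unit circle rationally by l ∈ F_q gives q distinct points w
-- of norm r.
--
-- For each such w, Cauchy–Schwarz applied to (a, c) ↦ a − wc on E² yields at least |E|⁴/q²
-- solutions in E⁴ of a − b = w(c − d). At most |E|² of them have c = d; every other one has
-- ‖a − b‖²/‖c − d‖² = ‖w‖² = r and determines w. Summing over w gives
-- q |E|⁴/q² ≤ V(r) + q |E|², which |E|² ≥ 2q² turns into |E|⁴ ≤ 2q V(r).

open import Level using (Level; 0ℓ)
open import Algebra.Bundles using (CommutativeRing)
open import Data.Nat.Base using (ℕ)
open import Defs

-- Normal forms are compared by refl, so the coefficients must compute: they are integers,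
-- mapped into R by fromℤ.
module IntegerCoefficientSolver {c ℓ : Level} (R : CommutativeRing c ℓ) where

  import Algebra.Properties.Ring as RingProperties
  import Algebra.Properties.Semiring.Mult.TCOptimised as SemiringMult
  import Algebra.Solver.Ring
  open import Algebra.Solver.Ring.AlmostCommutativeRing using (fromCommutativeRing; _-Raw-AlmostCommutative⟶_)
  open import Data.Integer.Base as ℤ using (ℤ; +_; -[1+_]; _⊖_; _◃_)
  import Data.Integer.Properties as ℤₚ
  open import Data.Maybe.Base using (Maybe; just; nothing)
  open import Data.Nat.Base as ℕ using (zero; suc)
  import Data.Nat.Properties as ℕₚ
  open import Data.Sign.Base as Sign using ()
  open import Relation.Nullary using (yes; no)
  open import Relation.Binary.PropositionalEquality as ≡ using (cong)

  open CommutativeRing R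
  open RingProperties ring using (-‿involutive; -‿+-comm; -0#≈0#; -‿distribˡ-*; -‿distribʳ-*)
  open SemiringMult semiring using (_×_; 1+×; ×-homo-+; ×1-homo-*)
  open import Algebra.Properties.CommutativeSemigroup +-commutativeSemigroup using (interchange)
  open import Relation.Binary.Reasoning.Setoid setoid

  -- The optimised _×_ makes fromℤ (+ 1) reduce to 1#, so con (+ 1) stands for 1# in solver goals.
  fromℤ : ℤ → Carrier
  fromℤ (+ n) = n × 1#
  fromℤ -[1+ n ] = - (suc n × 1#)

  fromℤ-⊖ : ∀ m n → fromℤ (m ⊖ n) ≈ m × 1# - n × 1#
  fromℤ-⊖ m zero = begin
    fromℤ (m ⊖ 0)      ≡⟨ cong fromℤ (ℤₚ.⊖-≥ {m} ℕ.z≤n) ⟩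
    m × 1#             ≈⟨ +-identityʳ (m × 1#) ⟨
    m × 1# + 0#        ≈⟨ +-congˡ -0#≈0# ⟨
    m × 1# - 0#        ∎
  fromℤ-⊖ zero (suc n) = begin
    fromℤ (0 ⊖ suc n)  ≡⟨ cong fromℤ (ℤₚ.⊖-< {n = suc n} ℕ.z<s) ⟩
    - (suc n × 1#)     ≈⟨ +-identityˡ _ ⟨
    0# - suc n × 1#    ∎
  fromℤ-⊖ (suc m) (suc n) = begin
    fromℤ (suc m ⊖ suc n)            ≡⟨ cong fromℤ (ℤₚ.[1+m]⊖[1+n]≡m⊖n m n) ⟩
    fromℤ (m ⊖ n)                    ≈⟨ fromℤ-⊖ m n ⟩
    m × 1# - n × 1#                  ≈⟨ +-identityˡ _ ⟨
    0# + (m × 1# - n × 1#)           ≈⟨ +-congʳ (-‿inverseʳ 1#) ⟨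
    (1# - 1#) + (m × 1# - n × 1#)    ≈⟨ interchange 1# (- 1#) (m × 1#) (- (n × 1#)) ⟩
    (1# + m × 1#) + (- 1# - n × 1#)  ≈⟨ +-congˡ (-‿+-comm 1# (n × 1#)) ⟩
    (1# + m × 1#) - (1# + n × 1#)    ≈⟨ +-cong (1+× m 1#) (-‿cong (1+× n 1#)) ⟨
    suc m × 1# - suc n × 1#          ∎

  fromℤ-+ : ∀ i j → fromℤ (i ℤ.+ j) ≈ fromℤ i + fromℤ j
  fromℤ-+ (+ m) (+ n) = ×-homo-+ 1# m n
  fromℤ-+ (+ m) -[1+ n ] = fromℤ-⊖ m (suc n)
  fromℤ-+ -[1+ m ] (+ n) = trans (fromℤ-⊖ n (suc m)) (+-comm _ _)
  fromℤ-+ -[1+ m ] -[1+ n ] = begin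
    - (suc (suc (m ℕ.+ n)) × 1#)     ≡⟨ cong (λ k → - (suc k × 1#)) (ℕₚ.+-suc m n) ⟨
    - ((suc m ℕ.+ suc n) × 1#)       ≈⟨ -‿cong (×-homo-+ 1# (suc m) (suc n)) ⟩
    - (suc m × 1# + suc n × 1#)      ≈⟨ -‿+-comm _ _ ⟨
    - (suc m × 1#) + - (suc n × 1#)  ∎

  fromℤ-+◃ : ∀ n → fromℤ (Sign.+ ◃ n) ≈ n × 1#
  fromℤ-+◃ zero = refl
  fromℤ-+◃ (suc n) = refl

  fromℤ--◃ : ∀ n → fromℤ (Sign.- ◃ n) ≈ - (n × 1#)
  fromℤ--◃ zero = sym -0#≈0#
  fromℤ--◃ (suc n) = refl

  fromℤ-* : ∀ i j → fromℤ (i ℤ.* j) ≈ fromℤ i * fromℤ j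
  fromℤ-* (+ m) (+ n) = trans (fromℤ-+◃ (m ℕ.* n)) (×1-homo-* m n)
  fromℤ-* (+ m) -[1+ n ] = begin
    fromℤ (Sign.- ◃ m ℕ.* suc n)     ≈⟨ fromℤ--◃ (m ℕ.* suc n) ⟩
    - ((m ℕ.* suc n) × 1#)           ≈⟨ -‿cong (×1-homo-* m (suc n)) ⟩
    - (m × 1# * suc n × 1#)          ≈⟨ -‿distribʳ-* _ _ ⟩
    m × 1# * - (suc n × 1#)          ∎
  fromℤ-* -[1+ m ] (+ n) = begin
    fromℤ (Sign.- ◃ suc m ℕ.* n)     ≈⟨ fromℤ--◃ (suc m ℕ.* n) ⟩
    - ((suc m ℕ.* n) × 1#)           ≈⟨ -‿cong (×1-homo-* (suc m) n) ⟩
    - (suc m × 1# * n × 1#)          ≈⟨ -‿distribˡ-* _ _ ⟩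
    - (suc m × 1#) * n × 1#          ∎
  fromℤ-* -[1+ m ] -[1+ n ] = begin
    fromℤ (Sign.+ ◃ suc m ℕ.* suc n) ≈⟨ fromℤ-+◃ (suc m ℕ.* suc n) ⟩
    (suc m ℕ.* suc n) × 1#           ≈⟨ ×1-homo-* (suc m) (suc n) ⟩
    suc m × 1# * suc n × 1#          ≈⟨ -‿involutive _ ⟨
    - - (suc m × 1# * suc n × 1#)    ≈⟨ -‿cong (-‿distribˡ-* _ _) ⟩
    - (- (suc m × 1#) * suc n × 1#)  ≈⟨ -‿distribʳ-* _ _ ⟩
    - (suc m × 1#) * - (suc n × 1#)  ∎

  fromℤ-neg : ∀ i → fromℤ (ℤ.- i) ≈ - fromℤ i
  fromℤ-neg (+ zero) = sym -0#≈0#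
  fromℤ-neg (+ suc n) = refl
  fromℤ-neg -[1+ n ] = sym (-‿involutive _)

  fromℤ-morphism : ℤ.+-*-rawRing -Raw-AlmostCommutative⟶ fromCommutativeRing R
  fromℤ-morphism = record
    { ⟦_⟧ = fromℤ ; +-homo = fromℤ-+ ; *-homo = fromℤ-* ; -‿homo = fromℤ-neg
    ; 0-homo = refl ; 1-homo = refl }

  fromℤ-equal? : ∀ i j → Maybe (fromℤ i ≈ fromℤ j)
  fromℤ-equal? i j with i ℤₚ.≟ j
  ... | yes ≡.refl = just refl
  ... | no _ = nothing

  open Algebra.Solver.Ring ℤ.+-*-rawRing (fromCommutativeRing R) fromℤ-morphism fromℤ-equal? public

  :1 : ∀ {n} → Polynomial n
  :1 = con (+ 1)

module FiniteSums where

  open import Data.Empty using (⊥-elim)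
  open import Data.List.Base using (List; []; _∷_; _++_; map; concat; concatMap; cartesianProduct; filter; length)
  open import Data.Nat.Base using (ℕ; _+_; _*_; _≤_; z≤n; s≤s)
  open import Data.Nat.Divisibility using (_∣_; ∣m∣n⇒∣m+n; _∣0)
  open import Data.Nat.Properties
  open import Algebra.Properties.CommutativeSemigroup +-commutativeSemigroup using (interchange)
  open import Data.Nat.Tactic.RingSolver using (solve-∀)
  open import Data.Product.Base using (_×_; _,_; ∃-syntax)
  open import Data.Sum.Base using (inj₁; inj₂)
  open import Function.Base using (const)
  open import Relation.Nullary using (Dec; yes; no; ¬_)
  open import Relation.Nullary.Decidable using (_×-dec_; ¬?)
  open import Relation.Binary.PropositionalEquality

  𝟙 : {P : Set} → Dec P → ℕ
  𝟙 (yes _) = 1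
  𝟙 (no _) = 0

  module _ {P Q : Set} where

    𝟙-cong : (p : Dec P) (q : Dec Q) → (P → Q) → (Q → P) → 𝟙 p ≡ 𝟙 q
    𝟙-cong (yes _) (yes _) _ _ = refl
    𝟙-cong (yes p) (no ¬q) f _ = ⊥-elim (¬q (f p))
    𝟙-cong (no ¬p) (yes q) _ g = ⊥-elim (¬p (g q))
    𝟙-cong (no _) (no _) _ _ = refl

    𝟙-× : (p : Dec P) (q : Dec Q) → 𝟙 (p ×-dec q) ≡ 𝟙 p * 𝟙 q
    𝟙-× (yes _) (yes _) = refl
    𝟙-× (yes _) (no _) = refl
    𝟙-× (no _) _ = refl

  module _ {P : Set} where

    𝟙-yes : (p : Dec P) → P → 𝟙 p ≡ 1
    𝟙-yes (yes _) _ = refl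
    𝟙-yes (no ¬p) p = ⊥-elim (¬p p)

    𝟙-no : (p : Dec P) → ¬ P → 𝟙 p ≡ 0
    𝟙-no (yes p) ¬p = ⊥-elim (¬p p)
    𝟙-no (no _) _ = refl

    𝟙≢0⇒holds : (p : Dec P) → 𝟙 p ≢ 0 → P
    𝟙≢0⇒holds (yes p) _ = p
    𝟙≢0⇒holds (no _) 𝟙p≢0 = ⊥-elim (𝟙p≢0 refl)

    𝟙≤1 : (p : Dec P) → 𝟙 p ≤ 1
    𝟙≤1 (yes _) = s≤s z≤n
    𝟙≤1 (no _) = z≤n

    𝟙-¬+𝟙 : (p : Dec P) → 𝟙 (¬? p) + 𝟙 p ≡ 1
    𝟙-¬+𝟙 (yes _) = refl
    𝟙-¬+𝟙 (no _) = refl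

  ∑ : {A : Set} → List A → (A → ℕ) → ℕ
  ∑ [] f = 0
  ∑ (x ∷ xs) f = f x + ∑ xs f

  infix 5 ∑
  syntax ∑ xs (λ x → e) = ∑[ x ∈ xs ] e

  ∑-map : ∀ {A B : Set} (g : A → B) (xs : List A) (f : B → ℕ) → ∑ (map g xs) f ≡ ∑[ x ∈ xs ] f (g x)
  ∑-map g [] f = refl
  ∑-map g (x ∷ xs) f = cong (f (g x) +_) (∑-map g xs f)

  module _ {A : Set} where

    ∑-cong : ∀ (xs : List A) {f g : A → ℕ} → f ≗ g → ∑ xs f ≡ ∑ xs g
    ∑-cong [] _ = refl
    ∑-cong (x ∷ xs) f≗g = cong₂ _+_ (f≗g x) (∑-cong xs f≗g)

    ∑-mono-≤ : ∀ (xs : List A) {f g : A → ℕ} → (∀ x → f x ≤ g x) → ∑ xs f ≤ ∑ xs g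
    ∑-mono-≤ [] _ = z≤n
    ∑-mono-≤ (x ∷ xs) f≤g = +-mono-≤ (f≤g x) (∑-mono-≤ xs f≤g)

    ∑-distrib-+ : ∀ (xs : List A) (f g : A → ℕ) → ∑[ x ∈ xs ] (f x + g x) ≡ ∑ xs f + ∑ xs g
    ∑-distrib-+ [] _ _ = refl
    ∑-distrib-+ (x ∷ xs) f g =
      trans (cong (f x + g x +_) (∑-distrib-+ xs f g)) (interchange (f x) (g x) (∑ xs f) (∑ xs g))

    ∑-distribˡ-* : ∀ (xs : List A) (c : ℕ) (f : A → ℕ) → ∑[ x ∈ xs ] c * f x ≡ c * ∑ xs f
    ∑-distribˡ-* [] c _ = sym (*-zeroʳ c)
    ∑-distribˡ-* (x ∷ xs) c f =
      trans (cong (c * f x +_) (∑-distribˡ-* xs c f)) (sym (*-distribˡ-+ c (f x) (∑ xs f)))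

    ∑-distribʳ-* : ∀ (xs : List A) (c : ℕ) (f : A → ℕ) → ∑[ x ∈ xs ] f x * c ≡ ∑ xs f * c
    ∑-distribʳ-* xs c f = begin
      ∑[ x ∈ xs ] f x * c  ≡⟨ ∑-cong xs (λ x → *-comm (f x) c) ⟩
      ∑[ x ∈ xs ] c * f x  ≡⟨ ∑-distribˡ-* xs c f ⟩
      c * ∑ xs f           ≡⟨ *-comm c (∑ xs f) ⟩
      ∑ xs f * c           ∎
      where open ≡-Reasoning

    ∑-const : ∀ (xs : List A) (c : ℕ) → ∑ xs (const c) ≡ length xs * c
    ∑-const [] _ = refl
    ∑-const (x ∷ xs) c = cong (c +_) (∑-const xs c)

    ∑-const-0 : ∀ (xs : List A) {f : A → ℕ} → (∀ x → f x ≡ 0) → ∑ xs f ≡ 0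
    ∑-const-0 xs f≗0 = trans (∑-cong xs f≗0) (trans (∑-const xs 0) (*-zeroʳ (length xs)))

    length≡∑1 : ∀ (xs : List A) → length xs ≡ ∑ xs (const 1)
    length≡∑1 xs = trans (sym (*-identityʳ (length xs))) (sym (∑-const xs 1))

    ∑-++ : ∀ (xs ys : List A) (f : A → ℕ) → ∑ (xs ++ ys) f ≡ ∑ xs f + ∑ ys f
    ∑-++ [] _ _ = refl
    ∑-++ (x ∷ xs) ys f = trans (cong (f x +_) (∑-++ xs ys f)) (sym (+-assoc (f x) (∑ xs f) (∑ ys f)))

    ∑-∣ : ∀ (xs : List A) {d : ℕ} {f : A → ℕ} → (∀ x → d ∣ f x) → d ∣ ∑ xs f
    ∑-∣ [] {d} _ = d ∣0
    ∑-∣ (x ∷ xs) d∣f = ∣m∣n⇒∣m+n (d∣f x) (∑-∣ xs d∣f)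

    ∑≢0⇒∃ : ∀ (xs : List A) (f : A → ℕ) → ∑ xs f ≢ 0 → ∃[ x ] f x ≢ 0
    ∑≢0⇒∃ [] _ ∑≢0 = ⊥-elim (∑≢0 refl)
    ∑≢0⇒∃ (x ∷ xs) f ∑≢0 with f x ≟ 0
    ... | no fx≢0 = x , fx≢0
    ... | yes fx≡0 = ∑≢0⇒∃ xs f (λ ∑xs≡0 → ∑≢0 (cong₂ _+_ fx≡0 ∑xs≡0))

    ∑-filter : ∀ {P : A → Set} (P? : ∀ x → Dec (P x)) (xs : List A) (f : A → ℕ) →
               ∑ (filter P? xs) f ≡ ∑[ x ∈ xs ] 𝟙 (P? x) * f x
    ∑-filter P? [] f = refl
    ∑-filter P? (x ∷ xs) f with P? x
    ... | yes _ = cong₂ _+_ (sym (+-identityʳ (f x))) (∑-filter P? xs f)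
    ... | no _ = ∑-filter P? xs f

    length-filter≡∑𝟙 : ∀ {P : A → Set} (P? : ∀ x → Dec (P x)) (xs : List A) →
                       length (filter P? xs) ≡ ∑[ x ∈ xs ] 𝟙 (P? x)
    length-filter≡∑𝟙 P? xs = begin
      length (filter P? xs)       ≡⟨ length≡∑1 (filter P? xs) ⟩
      ∑ (filter P? xs) (const 1)  ≡⟨ ∑-filter P? xs (const 1) ⟩
      ∑[ x ∈ xs ] 𝟙 (P? x) * 1    ≡⟨ ∑-cong xs (λ x → *-identityʳ (𝟙 (P? x))) ⟩
      ∑[ x ∈ xs ] 𝟙 (P? x)        ∎
      where open ≡-Reasoning

    ∑-square : ∀ (xs : List A) (f : A → ℕ) → ∑ xs f * ∑ xs f ≡ ∑[ x ∈ xs ] ∑[ y ∈ xs ] f x * f y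
    ∑-square xs f =
      trans (sym (∑-distribʳ-* xs (∑ xs f) f)) (∑-cong xs (λ x → sym (∑-distribˡ-* xs (f x) f)))

  module _ {A B : Set} where

    ∑-concatMap : ∀ (g : A → List B) (xs : List A) (f : B → ℕ) →
                  ∑ (concatMap g xs) f ≡ ∑[ x ∈ xs ] ∑ (g x) f
    ∑-concatMap g [] f = refl
    ∑-concatMap g (x ∷ xs) f =
      trans (∑-++ (g x) (concat (map g xs)) f) (cong (∑ (g x) f +_) (∑-concatMap g xs f))

    ∑-cartesianProduct : ∀ (xs : List A) (ys : List B) (f : A × B → ℕ) →
                         ∑ (cartesianProduct xs ys) f ≡ ∑[ x ∈ xs ] ∑[ y ∈ ys ] f (x , y)
    ∑-cartesianProduct [] ys f = refl
    ∑-cartesianProduct (x ∷ xs) ys f =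
      trans (∑-++ (map (x ,_) ys) _ f) (cong₂ _+_ (∑-map (x ,_) ys f) (∑-cartesianProduct xs ys f))

    ∑-comm : ∀ (xs : List A) (ys : List B) (f : A → B → ℕ) →
             ∑[ x ∈ xs ] ∑[ y ∈ ys ] f x y ≡ ∑[ y ∈ ys ] ∑[ x ∈ xs ] f x y
    ∑-comm [] ys f = sym (∑-const-0 ys (λ _ → refl))
    ∑-comm (x ∷ xs) ys f = trans (cong (∑ ys (f x) +_) (∑-comm xs ys f))
                                 (sym (∑-distrib-+ ys (f x) (λ y → ∑[ x′ ∈ xs ] f x′ y)))

    length-cartesianProduct : ∀ (xs : List A) (ys : List B) →
                              length (cartesianProduct xs ys) ≡ length xs * length ys
    length-cartesianProduct xs ys = begin
      length (cartesianProduct xs ys)       ≡⟨ length≡∑1 (cartesianProduct xs ys) ⟩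
      ∑ (cartesianProduct xs ys) (const 1)  ≡⟨ ∑-cartesianProduct xs ys (const 1) ⟩
      ∑[ x ∈ xs ] ∑ ys (const 1)            ≡⟨ ∑-cong xs (λ _ → sym (length≡∑1 ys)) ⟩
      ∑ xs (const (length ys))              ≡⟨ ∑-const xs (length ys) ⟩
      length xs * length ys                 ∎
      where open ≡-Reasoning

  m≤n⇒2*m*n≤m*m+n*n : ∀ {m n} → m ≤ n → 2 * (m * n) ≤ m * m + n * n
  m≤n⇒2*m*n≤m*m+n*n {m} m≤n with k , refl ← m≤n⇒∃[o]m+o≡n m≤n =
    ≤-trans (m≤m+n _ (k * k)) (≤-reflexive (square-of-sum m k))
    where
    square-of-sum : ∀ m k → 2 * (m * (m + k)) + k * k ≡ m * m + (m + k) * (m + k)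
    square-of-sum = solve-∀

  2*m*n≤m*m+n*n : ∀ m n → 2 * (m * n) ≤ m * m + n * n
  2*m*n≤m*m+n*n m n with ≤-total m n
  ... | inj₁ m≤n = m≤n⇒2*m*n≤m*m+n*n m≤n
  ... | inj₂ n≤m = subst₂ _≤_ (cong (2 *_) (*-comm n m)) (+-comm (n * n) (m * m)) (m≤n⇒2*m*n≤m*m+n*n n≤m)

  cauchy-schwarz : ∀ {A : Set} (xs : List A) (f : A → ℕ) →
                   ∑ xs f * ∑ xs f ≤ length xs * (∑[ x ∈ xs ] f x * f x)
  cauchy-schwarz xs f = *-cancelˡ-≤ 2 (begin
    2 * (∑ xs f * ∑ xs f)                                  ≡⟨ cong (2 *_) (∑-square xs f) ⟩
    2 * (∑[ x ∈ xs ] ∑[ y ∈ xs ] f x * f y)                ≡⟨ ∑-distribˡ-* xs 2 _ ⟨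
    ∑[ x ∈ xs ] 2 * (∑[ y ∈ xs ] f x * f y)                ≡⟨ ∑-cong xs (λ x → ∑-distribˡ-* xs 2 _) ⟨
    ∑[ x ∈ xs ] ∑[ y ∈ xs ] 2 * (f x * f y)                ≤⟨ ∑-mono-≤ xs (λ x → ∑-mono-≤ xs (λ y →
                                                                2*m*n≤m*m+n*n (f x) (f y))) ⟩
    ∑[ x ∈ xs ] ∑[ y ∈ xs ] (f x * f x + f y * f y)        ≡⟨ ∑-cong xs (λ x → ∑-distrib-+ xs _ _) ⟩
    ∑[ x ∈ xs ] ((∑[ y ∈ xs ] f x * f x) + S)              ≡⟨ ∑-distrib-+ xs _ _ ⟩
    (∑[ x ∈ xs ] ∑[ y ∈ xs ] f x * f x) + (∑[ x ∈ xs ] S)  ≡⟨ cong₂ _+_ (∑-cong xs (λ x → ∑-const xs (f x * f x)))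
                                                                       (∑-const xs S) ⟩
    (∑[ x ∈ xs ] length xs * (f x * f x)) + length xs * S  ≡⟨ cong (_+ length xs * S) (∑-distribˡ-* xs (length xs) _) ⟩
    length xs * S + length xs * S                          ≡⟨ cong (length xs * S +_) (+-identityʳ _) ⟨
    2 * (length xs * S)                                    ∎)
    where
    open ≤-Reasoning
    S : ℕ
    S = ∑[ x ∈ xs ] f x * f x

module Enumerations where

  open FiniteSums
  open import Data.Empty using (⊥-elim)
  open import Data.Fin.Base using (Fin; zero; suc)
  import Data.Fin.Properties as Fin
  open import Data.List.Base using (List; _∷_; map; filter; cartesianProduct; length; allFin)
  open import Data.List.Properties using (map-tabulate)
  open import Data.Nat.Base using (ℕ; suc; _+_; _*_; _≤_; _<_; z≤n)
  import Data.Nat as ℕ using (_≟_; _<?_)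
  open import Data.Nat.Divisibility using (_∣_; *-monoʳ-∣; ∣m⇒∣m*n)
  open import Data.Nat.Properties
  open import Data.Product.Base using (_,_)
  open import Data.Product.Properties using (≡-dec; ,-injective)
  open import Function.Base using (id; const; _∘_)
  open import Function.Bundles using (_↔_; Inverse; mk↔ₛ′)
  open import Relation.Binary.Definitions using (DecidableEquality; tri<; tri≈; tri>)
  open import Relation.Nullary using (Dec; yes; no)
  open import Relation.Nullary.Decidable using (_×-dec_)
  open import Relation.Binary.PropositionalEquality

  module _ {A : Set} (_≟_ : DecidableEquality A) where

    multiplicity : List A → A → ℕ
    multiplicity xs z = ∑[ y ∈ xs ] 𝟙 (z ≟ y)

    IsEnumeration : List A → Set
    IsEnumeration xs = ∀ z → multiplicity xs z ≡ 1

    multiplicity-filter-≤ : ∀ {P : A → Set} (P? : ∀ x → Dec (P x)) xs z →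
                            multiplicity (filter P? xs) z ≤ multiplicity xs z
    multiplicity-filter-≤ P? xs z = begin
      multiplicity (filter P? xs) z     ≡⟨ ∑-filter P? xs _ ⟩
      ∑[ y ∈ xs ] 𝟙 (P? y) * 𝟙 (z ≟ y)  ≤⟨ ∑-mono-≤ xs (λ y → *-monoˡ-≤ (𝟙 (z ≟ y)) (𝟙≤1 (P? y))) ⟩
      ∑[ y ∈ xs ] 1 * 𝟙 (z ≟ y)         ≡⟨ ∑-cong xs (λ y → *-identityˡ (𝟙 (z ≟ y))) ⟩
      multiplicity xs z                 ∎
      where open ≤-Reasoning

  module Enumeration {A : Set} (_≟_ : DecidableEquality A) (xs : List A)
                     (enum : IsEnumeration _≟_ xs) where

    ∑-δ : ∀ z (f : A → ℕ) → ∑[ y ∈ xs ] 𝟙 (z ≟ y) * f y ≡ f z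
    ∑-δ z f = begin
      ∑[ y ∈ xs ] 𝟙 (z ≟ y) * f y  ≡⟨ ∑-cong xs pick ⟩
      ∑[ y ∈ xs ] 𝟙 (z ≟ y) * f z  ≡⟨ ∑-distribʳ-* xs (f z) _ ⟩
      multiplicity _≟_ xs z * f z  ≡⟨ cong (_* f z) (enum z) ⟩
      1 * f z                      ≡⟨ *-identityˡ (f z) ⟩
      f z                          ∎
      where
      open ≡-Reasoning
      pick : ∀ y → 𝟙 (z ≟ y) * f y ≡ 𝟙 (z ≟ y) * f z
      pick y with z ≟ y
      ... | yes refl = refl
      ... | no _ = refl

    ∑-𝟙-≟ : ∀ z → ∑[ y ∈ xs ] 𝟙 (y ≟ z) ≡ 1
    ∑-𝟙-≟ z = trans (∑-cong xs (λ y → 𝟙-cong (y ≟ z) (z ≟ y) sym sym)) (enum z)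

    f≤∑f : ∀ (f : A → ℕ) z → f z ≤ ∑ xs f
    f≤∑f f z = begin
      f z                          ≡⟨ ∑-δ z f ⟨
      ∑[ y ∈ xs ] 𝟙 (z ≟ y) * f y  ≤⟨ ∑-mono-≤ xs (λ y → *-monoˡ-≤ (f y) (𝟙≤1 (z ≟ y))) ⟩
      ∑[ y ∈ xs ] 1 * f y          ≡⟨ ∑-cong xs (λ y → *-identityˡ (f y)) ⟩
      ∑ xs f                       ∎
      where open ≤-Reasoning

    ∑-reindex : ∀ (σ : A ↔ A) (f : A → ℕ) → ∑[ x ∈ xs ] f (Inverse.to σ x) ≡ ∑ xs f
    ∑-reindex σ f = begin
      ∑[ x ∈ xs ] f (to x)                          ≡⟨ ∑-cong xs (λ x → ∑-δ (to x) f) ⟨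
      ∑[ x ∈ xs ] ∑[ y ∈ xs ] 𝟙 (to x ≟ y) * f y    ≡⟨ ∑-comm xs xs _ ⟩
      ∑[ y ∈ xs ] ∑[ x ∈ xs ] 𝟙 (to x ≟ y) * f y    ≡⟨ ∑-cong xs (λ y → ∑-distribʳ-* xs (f y) _) ⟩
      ∑[ y ∈ xs ] (∑[ x ∈ xs ] 𝟙 (to x ≟ y)) * f y  ≡⟨ ∑-cong xs (λ y → cong (_* f y) (one-preimage y)) ⟩
      ∑[ y ∈ xs ] 1 * f y                           ≡⟨ ∑-cong xs (λ y → *-identityˡ (f y)) ⟩
      ∑ xs f                                        ∎
      where
      open ≡-Reasoning
      open Inverse σ using (to; from; strictlyInverseˡ; strictlyInverseʳ)
      one-preimage : ∀ y → ∑[ x ∈ xs ] 𝟙 (to x ≟ y) ≡ 1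
      one-preimage y = trans (∑-cong xs (λ x → 𝟙-cong (to x ≟ y) (from y ≟ x)
                               (λ { refl → strictlyInverseʳ x }) (λ { refl → strictlyInverseˡ y })))
                             (enum (from y))

    ∑-𝟙-unique≤1 : ∀ {P : A → Set} (P? : ∀ x → Dec (P x)) → (∀ {x y} → P x → P y → x ≡ y) →
                   ∑[ x ∈ xs ] 𝟙 (P? x) ≤ 1
    ∑-𝟙-unique≤1 {P} P? unique with ∑[ x ∈ xs ] 𝟙 (P? x) ℕ.≟ 0
    ... | yes ∑≡0 = ≤-trans (≤-reflexive ∑≡0) z≤n
    ... | no ∑≢0 with x₀ , 𝟙≢0 ← ∑≢0⇒∃ xs _ ∑≢0 = begin
      ∑[ x ∈ xs ] 𝟙 (P? x)    ≡⟨ ∑-cong xs (λ y → 𝟙-cong (P? y) (x₀ ≟ y) (unique Px₀) (λ { refl → Px₀ })) ⟩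
      multiplicity _≟_ xs x₀  ≡⟨ enum x₀ ⟩
      1                       ∎
      where
      open ≤-Reasoning
      Px₀ : P x₀
      Px₀ = 𝟙≢0⇒holds (P? x₀) 𝟙≢0

    -- Each orbit {x, σ x} in the support of f is counted once, at its element of smaller index.
    ∑-divisible-by-involution :
      ∀ (idx : A → ℕ) → (∀ {x y} → idx x ≡ idx y → x ≡ y) →
      ∀ (σ : A → A) → (∀ x → σ (σ x) ≡ x) →
      ∀ (f : A → ℕ) → (∀ x → f (σ x) ≡ f x) → (∀ x → f x ≢ 0 → σ x ≢ x) →
      ∀ {d} → (∀ x → d ∣ f x) → 2 * d ∣ ∑ xs f
    ∑-divisible-by-involution idx idx-injective σ σ-involutive f f∘σ≗f σ-free {d} d∣f =
      subst (2 * d ∣_) (sym ∑f≡2*∑half) (*-monoʳ-∣ 2 (∑-∣ xs (λ x → ∣m⇒∣m*n _ (d∣f x))))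
      where
      before : ∀ x → Dec (idx x < idx (σ x))
      before x = idx x ℕ.<? idx (σ x)

      after : ∀ x → Dec (idx (σ x) < idx x)
      after x = idx (σ x) ℕ.<? idx x

      half : A → ℕ
      half x = f x * 𝟙 (before x)

      before-or-after : ∀ x → f x ≢ 0 → 𝟙 (before x) + 𝟙 (after x) ≡ 1
      before-or-after x fx≢0 with <-cmp (idx x) (idx (σ x))
      ... | tri< lt _ gt̸ = cong₂ _+_ (𝟙-yes (before x) lt) (𝟙-no (after x) gt̸)
      ... | tri≈ _ eq _ = ⊥-elim (σ-free x fx≢0 (sym (idx-injective eq)))
      ... | tri> lt̸ _ gt = cong₂ _+_ (𝟙-no (before x) lt̸) (𝟙-yes (after x) gt)

      split : ∀ x → f x ≡ half x + half (σ x)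
      split x rewrite σ-involutive x | f∘σ≗f x with f x ℕ.≟ 0
      ... | yes fx≡0 rewrite fx≡0 = refl
      ... | no fx≢0 = begin
        f x                                 ≡⟨ *-identityʳ (f x) ⟨
        f x * 1                             ≡⟨ cong (f x *_) (before-or-after x fx≢0) ⟨
        f x * (𝟙 (before x) + 𝟙 (after x))  ≡⟨ *-distribˡ-+ (f x) _ _ ⟩
        half x + f x * 𝟙 (after x)          ∎
        where open ≡-Reasoning

      ∑f≡2*∑half : ∑ xs f ≡ 2 * ∑ xs half
      ∑f≡2*∑half = begin
        ∑ xs f                                ≡⟨ ∑-cong xs split ⟩
        ∑[ x ∈ xs ] (half x + half (σ x))     ≡⟨ ∑-distrib-+ xs half (half ∘ σ) ⟩
        ∑ xs half + (∑[ x ∈ xs ] half (σ x))  ≡⟨ cong (∑ xs half +_)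
                                                   (∑-reindex (mk↔ₛ′ σ σ σ-involutive σ-involutive) half) ⟩
        ∑ xs half + ∑ xs half                 ≡⟨ cong (∑ xs half +_) (+-identityʳ _) ⟨
        2 * ∑ xs half                         ∎
        where open ≡-Reasoning

    cauchy-schwarz-collisions : ∀ {C : Set} (g : C → A) (cs : List C) →
      length cs * length cs ≤ length xs * (∑[ a ∈ cs ] ∑[ b ∈ cs ] 𝟙 (g a ≟ g b))
    cauchy-schwarz-collisions g cs =
      subst₂ (λ s t → s * s ≤ length xs * t) ∑-fibre ∑-fibre² (cauchy-schwarz xs fibre)
      where
      fibre : A → ℕ
      fibre y = ∑[ a ∈ cs ] 𝟙 (g a ≟ y)

      ∑-fibre : ∑ xs fibre ≡ length cs
      ∑-fibre = begin
        ∑[ y ∈ xs ] ∑[ a ∈ cs ] 𝟙 (g a ≟ y)    ≡⟨ ∑-comm xs cs _ ⟩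
        ∑[ a ∈ cs ] multiplicity _≟_ xs (g a)  ≡⟨ ∑-cong cs (λ a → enum (g a)) ⟩
        ∑ cs (const 1)                         ≡⟨ length≡∑1 cs ⟨
        length cs                              ∎
        where open ≡-Reasoning

      ∑-fibre² : ∑[ y ∈ xs ] fibre y * fibre y ≡ ∑[ a ∈ cs ] ∑[ b ∈ cs ] 𝟙 (g a ≟ g b)
      ∑-fibre² = begin
        ∑[ y ∈ xs ] fibre y * fibre y                  ≡⟨ ∑-cong xs (λ y → ∑-distribʳ-* cs (fibre y) _) ⟨
        ∑[ y ∈ xs ] ∑[ b ∈ cs ] 𝟙 (g b ≟ y) * fibre y  ≡⟨ ∑-comm xs cs _ ⟩
        ∑[ b ∈ cs ] ∑[ y ∈ xs ] 𝟙 (g b ≟ y) * fibre y  ≡⟨ ∑-cong cs (λ b → ∑-δ (g b) fibre) ⟩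
        ∑[ b ∈ cs ] ∑[ a ∈ cs ] 𝟙 (g a ≟ g b)          ≡⟨ ∑-comm cs cs _ ⟩
        ∑[ a ∈ cs ] ∑[ b ∈ cs ] 𝟙 (g a ≟ g b)          ∎
        where open ≡-Reasoning

  allFin-isEnumeration : ∀ n → IsEnumeration Fin._≟_ (allFin n)
  allFin-isEnumeration (suc n) k =
    trans (cong (λ is → multiplicity Fin._≟_ is k) allFin-suc) (multiplicity-zero∷map-suc k)
    where
    allFin-suc : allFin (suc n) ≡ zero ∷ map suc (allFin n)
    allFin-suc = cong (zero ∷_) (sym (map-tabulate {n = n} id suc))

    multiplicity-zero∷map-suc : ∀ k → multiplicity Fin._≟_ (zero ∷ map suc (allFin n)) k ≡ 1
    multiplicity-zero∷map-suc zero =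
      cong suc (trans (∑-map suc (allFin n) _) (∑-const-0 (allFin n) (λ _ → refl)))
    multiplicity-zero∷map-suc (suc k) = begin
      multiplicity Fin._≟_ (map suc (allFin n)) (suc k)  ≡⟨ ∑-map suc (allFin n) _ ⟩
      ∑[ i ∈ allFin n ] 𝟙 (suc k Fin.≟ suc i)            ≡⟨ ∑-cong (allFin n) (λ i → 𝟙-cong (suc k Fin.≟ suc i) (k Fin.≟ i)
                                                              Fin.suc-injective (cong suc)) ⟩
      multiplicity Fin._≟_ (allFin n) k                  ≡⟨ allFin-isEnumeration n k ⟩
      1                                                  ∎
      where open ≡-Reasoning

  module _ {A B : Set} (_≟ᴬ_ : DecidableEquality A) (_≟ᴮ_ : DecidableEquality B) where

    map-isEnumeration : ∀ (e : A ↔ B) xs → IsEnumeration _≟ᴬ_ xs → IsEnumeration _≟ᴮ_ (map (Inverse.to e) xs)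
    map-isEnumeration e xs enum z = begin
      ∑[ y ∈ map to xs ] 𝟙 (z ≟ᴮ y)  ≡⟨ ∑-map to xs _ ⟩
      ∑[ x ∈ xs ] 𝟙 (z ≟ᴮ to x)      ≡⟨ ∑-cong xs (λ x → 𝟙-cong (z ≟ᴮ to x) (from z ≟ᴬ x)
                                          (λ { refl → strictlyInverseʳ x }) (λ { refl → sym (strictlyInverseˡ z) })) ⟩
      multiplicity _≟ᴬ_ xs (from z)  ≡⟨ enum (from z) ⟩
      1                              ∎
      where
      open ≡-Reasoning
      open Inverse e using (to; from; strictlyInverseˡ; strictlyInverseʳ)

    multiplicity-cartesianProduct :
      ∀ xs ys a b → multiplicity (≡-dec _≟ᴬ_ _≟ᴮ_) (cartesianProduct xs ys) (a , b) ≡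
                    multiplicity _≟ᴬ_ xs a * multiplicity _≟ᴮ_ ys b
    multiplicity-cartesianProduct xs ys a b = begin
      ∑[ p ∈ cartesianProduct xs ys ] 𝟙 (≡-dec _≟ᴬ_ _≟ᴮ_ (a , b) p)
        ≡⟨ ∑-cartesianProduct xs ys _ ⟩
      ∑[ x ∈ xs ] ∑[ y ∈ ys ] 𝟙 (≡-dec _≟ᴬ_ _≟ᴮ_ (a , b) (x , y))
        ≡⟨ ∑-cong xs (λ x → ∑-cong ys (𝟙-pair x)) ⟩
      ∑[ x ∈ xs ] ∑[ y ∈ ys ] 𝟙 (a ≟ᴬ x) * 𝟙 (b ≟ᴮ y)
        ≡⟨ ∑-cong xs (λ x → ∑-distribˡ-* ys (𝟙 (a ≟ᴬ x)) _) ⟩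
      ∑[ x ∈ xs ] 𝟙 (a ≟ᴬ x) * multiplicity _≟ᴮ_ ys b
        ≡⟨ ∑-distribʳ-* xs _ _ ⟩
      multiplicity _≟ᴬ_ xs a * multiplicity _≟ᴮ_ ys b
        ∎
      where
      open ≡-Reasoning
      𝟙-pair : ∀ x y → 𝟙 (≡-dec _≟ᴬ_ _≟ᴮ_ (a , b) (x , y)) ≡ 𝟙 (a ≟ᴬ x) * 𝟙 (b ≟ᴮ y)
      𝟙-pair x y = trans (𝟙-cong (≡-dec _≟ᴬ_ _≟ᴮ_ (a , b) (x , y)) ((a ≟ᴬ x) ×-dec (b ≟ᴮ y))
                                  ,-injective (λ { (refl , refl) → refl }))
                         (𝟙-× (a ≟ᴬ x) (b ≟ᴮ y))

module Arithmetic where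

  open import Data.Nat.Base
  open import Data.Nat.Divisibility using (_∣_; divides; %-presˡ-∣)
  open import Data.Nat.Properties
  open import Algebra.Properties.CommutativeSemigroup +-commutativeSemigroup using (interchange)
  open import Data.Nat.Tactic.RingSolver using (solve-∀)
  open import Relation.Binary.PropositionalEquality
  open import Relation.Nullary using (¬_)

  m%4≡3⇒2∤m : ∀ {m} → m % 4 ≡ 3 → ¬ 2 ∣ m
  m%4≡3⇒2∤m m%4≡3 2∣m = 2∤3 (subst (2 ∣_) m%4≡3 (%-presˡ-∣ 2∣m (divides 2 refl)))
    where
    2∤3 : ¬ 2 ∣ 3
    2∤3 (divides (suc (suc _)) ())

  private
    n^4≡n²*n² : ∀ n → n ^ 4 ≡ (n * n) * (n * n)
    n^4≡n²*n² n = trans (sym (*-assoc n n (n * (n * 1)))) (cong (λ m → n * n * (n * m)) (*-identityʳ n))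

    factor-q : ∀ q n v → (q * q) * (v + q * (n * n)) ≡ q * (q * v + (q * q) * (n * n))
    factor-q = solve-∀

    double : ∀ q n → (q * q) * (n * n) + (q * q) * (n * n) ≡ 2 * (q * q) * (n * n)
    double = solve-∀

    quadruple : ∀ q v → (q * v + q * v) + (q * v + q * v) ≡ 4 * q * v
    quadruple = solve-∀

  n⁴≤4qv : ∀ q n v .{{_ : NonZero q}} → 2 * (q * q) ≤ n * n →
           q * ((n * n) * (n * n)) ≤ (q * q) * (v + q * (n * n)) → n ^ 4 ≤ 4 * q * v
  n⁴≤4qv q n v 2q²≤n² main = begin
    n ^ 4              ≡⟨ n^4≡n²*n² n ⟩
    A                  ≤⟨ +-cancelʳ-≤ (C + C) A (B + B) A+2C≤2B+2C ⟩
    B + B              ≤⟨ m≤m+n (B + B) (B + B) ⟩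
    (B + B) + (B + B)  ≡⟨ quadruple q v ⟩
    4 * q * v          ∎
    where
    open ≤-Reasoning
    A B C : ℕ
    A = (n * n) * (n * n)
    B = q * v
    C = (q * q) * (n * n)

    A≤B+C : A ≤ B + C
    A≤B+C = *-cancelˡ-≤ q (≤-trans main (≤-reflexive (factor-q q n v)))

    2C≤A : C + C ≤ A
    2C≤A = ≤-trans (≤-reflexive (double q n)) (*-monoˡ-≤ (n * n) 2q²≤n²)

    A+2C≤2B+2C : A + (C + C) ≤ (B + B) + (C + C)
    A+2C≤2B+2C = begin
      A + (C + C)        ≤⟨ +-monoʳ-≤ A 2C≤A ⟩
      A + A              ≤⟨ +-mono-≤ A≤B+C A≤B+C ⟩
      (B + C) + (B + C)  ≡⟨ interchange B C B C ⟩
      (B + B) + (C + C)  ∎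

module FiniteFieldProperties {q : ℕ} (F : FiniteField q) where

  open FiniteSums
  open Enumerations
  import Algebra.Properties.Ring as RingProperties
  open import Data.Bool.Base using (Bool; true)
  import Data.Bool.Properties as Bool
  open import Data.Empty using (⊥-elim)
  open import Data.Fin.Base using (toℕ)
  import Data.Fin.Properties as Fin
  open import Data.List.Base using (List; length; allFin; cartesianProduct)
  open import Data.List.Properties using (length-map; length-tabulate)
  open import Data.Nat.Base as ℕ using (_%_; z≤n; s≤s)
  import Data.Nat.Properties as ℕₚ
  open import Data.Nat.Divisibility using (_∣_; _∣0; ∣-refl)
  open import Data.Nat.DivMod using (%-remove-+ˡ)
  open import Data.Product.Base using (_×_; _,_; ∃-syntax; proj₁; proj₂)
  open import Data.Product.Properties using (≡-dec; ,-injectiveˡ; ,-injectiveʳ)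
  open import Data.Sum.Base using (_⊎_; inj₁; inj₂; [_,_]′)
  open import Function.Base using (id; const; _∘_)
  open import Function.Bundles using (_↔_; Inverse; mk↔ₛ′)
  open import Relation.Binary.Definitions using (DecidableEquality)
  open import Relation.Binary.PropositionalEquality
  open import Relation.Nullary using (Dec; yes; no)
  open import Relation.Nullary.Decidable using (_×-dec_; ¬?)

  open FiniteField F renaming (_≟_ to infix 4 _≟_; _-ᵖ_ to infixl 6 _-ᵖ_)

  commutativeRing : CommutativeRing 0ℓ 0ℓ
  commutativeRing = record { isCommutativeRing = isCommutativeRing }

  open CommutativeRing commutativeRing
    using (+-identityˡ; +-identityʳ; +-assoc; +-comm; *-assoc; *-identityˡ; *-identityʳ; zeroˡ; zeroʳ; -‿inverseʳ; ring)
  open RingProperties ring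
    using (x∙y⁻¹≈ε⇒x≈y; -‿involutive; -‿injective; -0#≈0#; +-cancelˡ; +-cancelʳ; +-inverseˡ-unique;
           -1*x≈-x; -‿distribʳ-*)
  open IntegerCoefficientSolver commutativeRing using (solve; _:=_; _:+_; _:*_; :-_; _:-_; :1)

  x-y≡0⇒x≡y : ∀ {x y} → x - y ≡ 0# → x ≡ y
  x-y≡0⇒x≡y = x∙y⁻¹≈ε⇒x≈y _ _

  x-u≡y-v⇒x-y≡u-v : ∀ {x y u v} → x - u ≡ y - v → x - y ≡ u - v
  x-u≡y-v⇒x-y≡u-v {x} {y} {u} {v} eq = begin
    x - y                        ≡⟨ solve 4 (λ x y u v → x :- y := (x :- u) :- (y :- v) :+ (u :- v)) refl x y u v ⟩
    (x - u) - (y - v) + (u - v)  ≡⟨ cong (λ t → t - (y - v) + (u - v)) eq ⟩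
    (y - v) - (y - v) + (u - v)  ≡⟨ cong (_+ (u - v)) (-‿inverseʳ (y - v)) ⟩
    0# + (u - v)                 ≡⟨ +-identityˡ (u - v) ⟩
    u - v                        ∎
    where open ≡-Reasoning

  *-cancelˡ : ∀ {x y z} → x ≢ 0# → x * y ≡ x * z → y ≡ z
  *-cancelˡ {x} {y} {z} x≢0 eq = begin
    y               ≡⟨ x⁻¹*[x*y]≡y y ⟨
    x ⁻¹ * (x * y)  ≡⟨ cong (x ⁻¹ *_) eq ⟩
    x ⁻¹ * (x * z)  ≡⟨ x⁻¹*[x*y]≡y z ⟩
    z               ∎
    where
    open ≡-Reasoning
    x⁻¹*[x*y]≡y : ∀ y → x ⁻¹ * (x * y) ≡ y
    x⁻¹*[x*y]≡y y = begin
      x ⁻¹ * (x * y)  ≡⟨ solve 3 (λ x x⁻¹ y → x⁻¹ :* (x :* y) := (x :* x⁻¹) :* y) refl x (x ⁻¹) y ⟩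
      (x * x ⁻¹) * y  ≡⟨ cong (_* y) (inverse x x≢0) ⟩
      1# * y          ≡⟨ *-identityˡ y ⟩
      y               ∎

  x*y≡0⇒x≡0∨y≡0 : ∀ {x y} → x * y ≡ 0# → x ≡ 0# ⊎ y ≡ 0#
  x*y≡0⇒x≡0∨y≡0 {x} xy≡0 with x ≟ 0#
  ... | yes x≡0 = inj₁ x≡0
  ... | no x≢0 = inj₂ (*-cancelˡ x≢0 (trans xy≡0 (sym (zeroʳ x))))

  x≢0⇒y≢0⇒x*y≢0 : ∀ {x y} → x ≢ 0# → y ≢ 0# → x * y ≢ 0#
  x≢0⇒y≢0⇒x*y≢0 x≢0 y≢0 xy≡0 = [ x≢0 , y≢0 ]′ (x*y≡0⇒x≡0∨y≡0 xy≡0)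

  x*x≡0⇒x≡0 : ∀ {x} → x * x ≡ 0# → x ≡ 0#
  x*x≡0⇒x≡0 xx≡0 = [ id , id ]′ (x*y≡0⇒x≡0∨y≡0 xx≡0)

  x*x≡y*y⇒x≡y∨x≡-y : ∀ {x y} → x * x ≡ y * y → x ≡ y ⊎ x ≡ - y
  x*x≡y*y⇒x≡y∨x≡-y {x} {y} eq with x*y≡0⇒x≡0∨y≡0 difference-of-squares
    where
    difference-of-squares : (x - y) * (x + y) ≡ 0#
    difference-of-squares = begin
      (x - y) * (x + y)  ≡⟨ solve 2 (λ x y → (x :- y) :* (x :+ y) := x :* x :- y :* y) refl x y ⟩
      x * x - y * y      ≡⟨ cong (_- y * y) eq ⟩
      y * y - y * y      ≡⟨ -‿inverseʳ (y * y) ⟩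
      0#                 ∎
      where open ≡-Reasoning
  ... | inj₁ x-y≡0 = inj₁ (x-y≡0⇒x≡y x-y≡0)
  ... | inj₂ x+y≡0 = inj₂ (x-y≡0⇒x≡y (trans (cong (x +_) (-‿involutive y)) x+y≡0))

  x≢0⇒x⁻¹≢0 : ∀ {x} → x ≢ 0# → x ⁻¹ ≢ 0#
  x≢0⇒x⁻¹≢0 {x} x≢0 x⁻¹≡0 = 0≢1 (begin
    0#        ≡⟨ zeroʳ x ⟨
    x * 0#    ≡⟨ cong (x *_) x⁻¹≡0 ⟨
    x * x ⁻¹  ≡⟨ inverse x x≢0 ⟩
    1#        ∎)
    where open ≡-Reasoning

  x*y/y≡x : ∀ x {y} → y ≢ 0# → (x * y) / y ≡ x
  x*y/y≡x x {y} y≢0 = begin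
    (x * y) * y ⁻¹  ≡⟨ *-assoc x y (y ⁻¹) ⟩
    x * (y * y ⁻¹)  ≡⟨ cong (x *_) (inverse y y≢0) ⟩
    x * 1#          ≡⟨ *-identityʳ x ⟩
    x               ∎
    where open ≡-Reasoning

  _≟ᵖ_ : DecidableEquality Point
  _≟ᵖ_ = ≡-dec _≟_ _≟_

  elements-isEnumeration : IsEnumeration _≟_ elements
  elements-isEnumeration = map-isEnumeration Fin._≟_ _≟_ enum (allFin q) (allFin-isEnumeration q)

  points-isEnumeration : IsEnumeration _≟ᵖ_ points
  points-isEnumeration (a , b) =
    trans (multiplicity-cartesianProduct _≟_ _≟_ elements elements a b)
          (cong₂ ℕ._*_ (elements-isEnumeration a) (elements-isEnumeration b))

  length-elements : length elements ≡ q
  length-elements = trans (length-map _ (allFin q)) (length-tabulate id)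

  length-points : length points ≡ q ℕ.* q
  length-points = trans (length-cartesianProduct elements elements) (cong₂ ℕ._*_ length-elements length-elements)

  module Elements = Enumeration _≟_ elements elements-isEnumeration
  module Points = Enumeration _≟ᵖ_ points points-isEnumeration

  ∑-elements-1 : ∑ elements (const 1) ≡ q
  ∑-elements-1 = trans (sym (length≡∑1 elements)) length-elements

  index : Carrier → ℕ
  index x = toℕ (Inverse.from enum x)

  index-injective : ∀ {x y} → index x ≡ index y → x ≡ y
  index-injective {x} {y} eq = begin
    x                  ≡⟨ Inverse.strictlyInverseˡ enum x ⟨
    Inverse.to enum _  ≡⟨ cong (Inverse.to enum) (Fin.toℕ-injective eq) ⟩
    Inverse.to enum _  ≡⟨ Inverse.strictlyInverseˡ enum y ⟩
    y                  ∎
    where open ≡-Reasoning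

  1+1≡0⇒2∣q : 1# + 1# ≡ 0# → 2 ∣ q
  1+1≡0⇒2∣q 1+1≡0 = subst (2 ∣_) ∑-elements-1
    (Elements.∑-divisible-by-involution index index-injective
      (_+ 1#) +1-involutive (const 1) (λ _ → refl) (λ x _ → x+1≢x x) (λ _ → ∣-refl))
    where
    +1-involutive : ∀ x → (x + 1#) + 1# ≡ x
    +1-involutive x = trans (+-assoc x 1# 1#) (trans (cong (x +_) 1+1≡0) (+-identityʳ x))
    x+1≢x : ∀ x → x + 1# ≢ x
    x+1≢x x x+1≡x = 0≢1 (sym (+-cancelˡ x 1# 0# (trans x+1≡x (sym (+-identityʳ x)))))

  #nonzero : ℕ
  #nonzero = ∑[ x ∈ elements ] 𝟙 (¬? (x ≟ 0#))

  #nonzero+1≡q : #nonzero ℕ.+ 1 ≡ q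
  #nonzero+1≡q = begin
    #nonzero ℕ.+ 1                                      ≡⟨ cong (#nonzero ℕ.+_) (Elements.∑-𝟙-≟ 0#) ⟨
    #nonzero ℕ.+ (∑[ x ∈ elements ] 𝟙 (x ≟ 0#))         ≡⟨ ∑-distrib-+ elements _ _ ⟨
    ∑[ x ∈ elements ] (𝟙 (¬? (x ≟ 0#)) ℕ.+ 𝟙 (x ≟ 0#))  ≡⟨ ∑-cong elements (λ x → 𝟙-¬+𝟙 (x ≟ 0#)) ⟩
    ∑ elements (const 1)                                ≡⟨ ∑-elements-1 ⟩
    q                                                   ∎
    where open ≡-Reasoning

  #roots : Carrier → ℕ
  #roots y = ∑[ x ∈ elements ] 𝟙 (x * x ≟ y)

  ∑-#roots : ∑ elements #roots ≡ q
  ∑-#roots = begin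
    ∑[ y ∈ elements ] ∑[ x ∈ elements ] 𝟙 (x * x ≟ y)    ≡⟨ ∑-comm elements elements _ ⟩
    ∑[ x ∈ elements ] multiplicity _≟_ elements (x * x)  ≡⟨ ∑-cong elements (λ x → elements-isEnumeration (x * x)) ⟩
    ∑ elements (const 1)                                 ≡⟨ ∑-elements-1 ⟩
    q                                                    ∎
    where open ≡-Reasoning

  ∑-#roots-nonzero : ∑[ y ∈ elements ] 𝟙 (¬? (y ≟ 0#)) ℕ.* #roots y ≡ #nonzero
  ∑-#roots-nonzero = begin
    ∑[ y ∈ elements ] 𝟙 (¬? (y ≟ 0#)) ℕ.* #roots y
      ≡⟨ ∑-cong elements (λ y → ∑-distribˡ-* elements (𝟙 (¬? (y ≟ 0#))) (λ x → 𝟙 (x * x ≟ y))) ⟨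
    ∑[ y ∈ elements ] ∑[ x ∈ elements ] 𝟙 (¬? (y ≟ 0#)) ℕ.* 𝟙 (x * x ≟ y)
      ≡⟨ ∑-comm elements elements _ ⟩
    ∑[ x ∈ elements ] ∑[ y ∈ elements ] 𝟙 (¬? (y ≟ 0#)) ℕ.* 𝟙 (x * x ≟ y)
      ≡⟨ ∑-cong elements (λ x → ∑-cong elements (λ y → ℕₚ.*-comm (𝟙 (¬? (y ≟ 0#))) (𝟙 (x * x ≟ y)))) ⟩
    ∑[ x ∈ elements ] ∑[ y ∈ elements ] 𝟙 (x * x ≟ y) ℕ.* 𝟙 (¬? (y ≟ 0#))
      ≡⟨ ∑-cong elements (λ x → Elements.∑-δ (x * x) _) ⟩
    ∑[ x ∈ elements ] 𝟙 (¬? (x * x ≟ 0#))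
      ≡⟨ ∑-cong elements (λ x → 𝟙-cong (¬? (x * x ≟ 0#)) (¬? (x ≟ 0#))
           (λ x*x≢0 x≡0 → x*x≢0 (trans (cong (λ t → t * t) x≡0) (zeroʳ 0#)))
           (λ x≢0 x*x≡0 → x≢0 (x*x≡0⇒x≡0 x*x≡0))) ⟩
    #nonzero
      ∎
    where open ≡-Reasoning

  #roots-0 : #roots 0# ≡ 1
  #roots-0 = trans (∑-cong elements (λ x → 𝟙-cong (x * x ≟ 0#) (x ≟ 0#) x*x≡0⇒x≡0 (λ { refl → zeroʳ 0# })))
                   (Elements.∑-𝟙-≟ 0#)

  #roots≢0⇒square : ∀ {y} → #roots y ≢ 0 → ∃[ x ] x * x ≡ y
  #roots≢0⇒square {y} #roots≢0 with x , 𝟙≢0 ← ∑≢0⇒∃ elements _ #roots≢0 = x , 𝟙≢0⇒holds (x * x ≟ y) 𝟙≢0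

  -- Multiplication by i permutes F_q and turns squares into their negatives.
  i*i+1≡0⇒#roots[-y]≡#roots[y] : ∀ {i} → i * i + 1# ≡ 0# → ∀ y → #roots (- y) ≡ #roots y
  i*i+1≡0⇒#roots[-y]≡#roots[y] {i} i*i+1≡0 y = begin
    ∑[ x ∈ elements ] 𝟙 (x * x ≟ - y)              ≡⟨ Elements.∑-reindex multiplication-by-i (λ x → 𝟙 (x * x ≟ - y)) ⟨
    ∑[ x ∈ elements ] 𝟙 ((i * x) * (i * x) ≟ - y)  ≡⟨ ∑-cong elements (λ x → 𝟙-cong ((i * x) * (i * x) ≟ - y) (x * x ≟ y)
                                                        (λ eq → -‿injective (trans (sym ([i*x]²≡-x² x)) eq))
                                                        (λ eq → trans ([i*x]²≡-x² x) (cong -_ eq))) ⟩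
    ∑[ x ∈ elements ] 𝟙 (x * x ≟ y)                ∎
    where
    open ≡-Reasoning

    i*[i*x]≡-x : ∀ x → i * (i * x) ≡ - x
    i*[i*x]≡-x x = begin
      i * (i * x)  ≡⟨ solve 2 (λ i x → i :* (i :* x) := (i :* i) :* x) refl i x ⟩
      (i * i) * x  ≡⟨ cong (_* x) (+-inverseˡ-unique (i * i) 1# i*i+1≡0) ⟩
      - 1# * x     ≡⟨ -1*x≈-x x ⟩
      - x          ∎

    [i*x]²≡-x² : ∀ x → (i * x) * (i * x) ≡ - (x * x)
    [i*x]²≡-x² x = trans (solve 2 (λ i x → (i :* x) :* (i :* x) := i :* (i :* (x :* x))) refl i x) (i*[i*x]≡-x (x * x))

    multiplication-by-i : Carrier ↔ Carrier
    multiplication-by-i = mk↔ₛ′ (i *_) (λ x → - (i * x)) left-inverse right-inverse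
      where
      left-inverse : ∀ x → i * - (i * x) ≡ x
      left-inverse x = trans (sym (-‿distribʳ-* i (i * x))) (trans (cong -_ (i*[i*x]≡-x x)) (-‿involutive x))
      right-inverse : ∀ x → - (i * (i * x)) ≡ x
      right-inverse x = trans (cong -_ (i*[i*x]≡-x x)) (-‿involutive x)

  module OddCharacteristic (1+1≢0 : 1# + 1# ≢ 0#) where

    x≢0⇒x≢-x : ∀ {x} → x ≢ 0# → x ≢ - x
    x≢0⇒x≢-x {x} x≢0 x≡-x = x≢0⇒y≢0⇒x*y≢0 1+1≢0 x≢0 (begin
      (1# + 1#) * x  ≡⟨ solve 1 (λ x → (:1 :+ :1) :* x := x :+ x) refl x ⟩
      x + x          ≡⟨ cong (x +_) x≡-x ⟩
      x - x          ≡⟨ -‿inverseʳ x ⟩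
      0#             ∎)
      where open ≡-Reasoning

    #roots[x*x]≡2 : ∀ {x} → x ≢ 0# → #roots (x * x) ≡ 2
    #roots[x*x]≡2 {x} x≢0 = begin
      ∑[ y ∈ elements ] 𝟙 (y * y ≟ x * x)                              ≡⟨ ∑-cong elements ±x ⟩
      ∑[ y ∈ elements ] (𝟙 (x ≟ y) ℕ.+ 𝟙 (- x ≟ y))                    ≡⟨ ∑-distrib-+ elements _ _ ⟩
      multiplicity _≟_ elements x ℕ.+ multiplicity _≟_ elements (- x)  ≡⟨ cong₂ ℕ._+_ (elements-isEnumeration x)
                                                                                        (elements-isEnumeration (- x)) ⟩
      2                                                                ∎
      where
      open ≡-Reasoning
      ±x : ∀ y → 𝟙 (y * y ≟ x * x) ≡ 𝟙 (x ≟ y) ℕ.+ 𝟙 (- x ≟ y)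
      ±x y with x ≟ y | - x ≟ y
      ... | yes refl | yes -x≡x = ⊥-elim (x≢0⇒x≢-x x≢0 (sym -x≡x))
      ... | yes refl | no _ = 𝟙-yes (x * x ≟ x * x) refl
      ... | no _ | yes refl = 𝟙-yes (- x * - x ≟ x * x) (solve 1 (λ x → (:- x) :* (:- x) := x :* x) refl x)
      ... | no x≢y | no -x≢y = 𝟙-no (y * y ≟ x * x) (λ yy≡xx →
        [ (λ y≡x → x≢y (sym y≡x)) , (λ y≡-x → -x≢y (sym y≡-x)) ]′ (x*x≡y*y⇒x≡y∨x≡-y yy≡xx))

    #roots≡0∨#roots≡2 : ∀ {y} → y ≢ 0# → #roots y ≡ 0 ⊎ #roots y ≡ 2
    #roots≡0∨#roots≡2 {y} y≢0 with #roots y ℕₚ.≟ 0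
    ... | yes #roots≡0 = inj₁ #roots≡0
    ... | no #roots≢0 with x , refl ← #roots≢0⇒square #roots≢0 =
      inj₂ (#roots[x*x]≡2 (λ x≡0 → y≢0 (trans (cong (λ t → t * t) x≡0) (zeroʳ 0#))))

    2∣#roots : ∀ {y} → y ≢ 0# → 2 ∣ #roots y
    2∣#roots y≢0 = [ (λ #roots≡0 → subst (2 ∣_) (sym #roots≡0) (2 ∣0)) ,
                     (λ #roots≡2 → subst (2 ∣_) (sym #roots≡2) ∣-refl) ]′ (#roots≡0∨#roots≡2 y≢0)

    i*i+1≡0⇒4∣#nonzero : ∀ {i} → i * i + 1# ≡ 0# → 4 ∣ #nonzero
    i*i+1≡0⇒4∣#nonzero i*i+1≡0 = subst (4 ∣_) ∑-#roots-nonzero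
      (Elements.∑-divisible-by-involution index index-injective -_ -‿involutive f f[-y]≡f[y] f≢0⇒-y≢y 2∣f)
      where
      f : Carrier → ℕ
      f y = 𝟙 (¬? (y ≟ 0#)) ℕ.* #roots y

      f[-y]≡f[y] : ∀ y → f (- y) ≡ f y
      f[-y]≡f[y] y = cong₂ ℕ._*_
        (𝟙-cong (¬? (- y ≟ 0#)) (¬? (y ≟ 0#))
          (λ -y≢0 y≡0 → -y≢0 (trans (cong -_ y≡0) -0#≈0#))
          (λ y≢0 -y≡0 → y≢0 (trans (sym (-‿involutive y)) (trans (cong -_ -y≡0) -0#≈0#))))
        (i*i+1≡0⇒#roots[-y]≡#roots[y] i*i+1≡0 y)

      f≢0⇒-y≢y : ∀ y → f y ≢ 0 → - y ≢ y
      f≢0⇒-y≢y y fy≢0 with y ≟ 0#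
      ... | yes _ = ⊥-elim (fy≢0 refl)
      ... | no y≢0 = λ -y≡y → x≢0⇒x≢-x y≢0 (sym -y≡y)

      2∣f : ∀ y → 2 ∣ f y
      2∣f y with y ≟ 0#
      ... | yes _ = 2 ∣0
      ... | no y≢0 = subst (2 ∣_) (sym (ℕₚ.*-identityˡ (#roots y))) (2∣#roots y≢0)

    i*i+1≡0⇒q%4≡1 : ∀ {i} → i * i + 1# ≡ 0# → q % 4 ≡ 1
    i*i+1≡0⇒q%4≡1 i*i+1≡0 = trans (cong (_% 4) (sym #nonzero+1≡q)) (%-remove-+ˡ 1 (i*i+1≡0⇒4∣#nonzero i*i+1≡0))

    -- Counting 0 twice makes #roots′ vanish exactly where #roots does, and stay ≤ 2 everywhere.
    #roots′ : Carrier → ℕ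
    #roots′ y = #roots y ℕ.+ 𝟙 (y ≟ 0#)

    #roots′≤2 : ∀ y → #roots′ y ℕ.≤ 2
    #roots′≤2 y with y ≟ 0#
    ... | yes refl = ℕₚ.≤-reflexive (cong (ℕ._+ 1) #roots-0)
    ... | no y≢0 = [ (λ #roots≡0 → ℕₚ.≤-trans (ℕₚ.≤-reflexive (cong (ℕ._+ 0) #roots≡0)) z≤n) ,
                     (λ #roots≡2 → ℕₚ.≤-reflexive (cong (ℕ._+ 0) #roots≡2)) ]′ (#roots≡0∨#roots≡2 y≢0)

    #roots≡0⇒#roots′≡0 : ∀ {y} → #roots y ≡ 0 → #roots′ y ≡ 0
    #roots≡0⇒#roots′≡0 {y} #roots≡0 = cong₂ ℕ._+_ #roots≡0 (𝟙-no (y ≟ 0#) y≢0)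
      where
      y≢0 : y ≢ 0#
      y≢0 refl = ℕₚ.1+n≢0 (trans (sym #roots-0) #roots≡0)

    ∑-#roots′ : ∑ elements #roots′ ≡ q ℕ.+ 1
    ∑-#roots′ = trans (∑-distrib-+ elements _ _) (cong₂ ℕ._+_ ∑-#roots (Elements.∑-𝟙-≟ 0#))

    ∑-#roots′[r-b] : ∀ r → ∑[ b ∈ elements ] #roots′ (r - b) ≡ q ℕ.+ 1
    ∑-#roots′[r-b] r = trans (Elements.∑-reindex (mk↔ₛ′ (λ x → r - x) (λ x → r - x) r-[r-x]≡x r-[r-x]≡x) #roots′)
                             ∑-#roots′
      where
      r-[r-x]≡x : ∀ x → r - (r - x) ≡ x
      r-[r-x]≡x = solve 2 (λ r x → r :- (r :- x) := x) refl r

    #roots′+#roots′[r-b]≤2 : ∀ {r} → (∀ x y → x * x + y * y ≢ r) → ∀ b → #roots′ b ℕ.+ #roots′ (r - b) ℕ.≤ 2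
    #roots′+#roots′[r-b]≤2 {r} unrepresentable b with #roots b ℕₚ.≟ 0 | #roots (r - b) ℕₚ.≟ 0
    ... | yes #roots≡0 | _ rewrite #roots≡0⇒#roots′≡0 #roots≡0 = #roots′≤2 (r - b)
    ... | no _ | yes #roots≡0 rewrite #roots≡0⇒#roots′≡0 #roots≡0 =
      ℕₚ.≤-trans (ℕₚ.≤-reflexive (ℕₚ.+-identityʳ (#roots′ b))) (#roots′≤2 b)
    ... | no #roots≢0 | no #roots′≢0
      with x , refl ← #roots≢0⇒square #roots≢0 | y , y*y≡r-b ← #roots≢0⇒square #roots′≢0 =
      ⊥-elim (unrepresentable x y (trans (cong (x * x +_) y*y≡r-b)
                                         (solve 2 (λ b r → b :+ (r :- b) := r) refl (x * x) r)))

    -- Otherwise the (q + 1)/2 squares and the (q + 1)/2 values r − y² would be disjoint.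
    sum-of-two-squares : ∀ r → ∃[ s ] ‖ s ‖² ≡ r
    sum-of-two-squares r with ∑[ p ∈ points ] 𝟙 (‖ p ‖² ≟ r) ℕₚ.≟ 0
    ... | no ∑≢0 with s , 𝟙≢0 ← ∑≢0⇒∃ points _ ∑≢0 = s , 𝟙≢0⇒holds (‖ s ‖² ≟ r) 𝟙≢0
    ... | yes ∑≡0 = ⊥-elim (ℕₚ.<-irrefl refl (begin-strict
      q ℕ.+ q                                                       <⟨ ℕₚ.+-mono-< q<q+1 q<q+1 ⟩
      (q ℕ.+ 1) ℕ.+ (q ℕ.+ 1)                                       ≡⟨ cong₂ ℕ._+_ ∑-#roots′ (∑-#roots′[r-b] r) ⟨
      ∑ elements #roots′ ℕ.+ (∑[ b ∈ elements ] #roots′ (r - b))    ≡⟨ ∑-distrib-+ elements _ _ ⟨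
      ∑[ b ∈ elements ] (#roots′ b ℕ.+ #roots′ (r - b))             ≤⟨ ∑-mono-≤ elements
                                                                         (#roots′+#roots′[r-b]≤2 unrepresentable) ⟩
      ∑ elements (const 2)                                          ≡⟨ ∑-const elements 2 ⟩
      length elements ℕ.* 2                                         ≡⟨ cong (ℕ._* 2) length-elements ⟩
      q ℕ.* 2                                                       ≡⟨ ℕₚ.*-comm q 2 ⟩
      q ℕ.+ (q ℕ.+ 0)                                               ≡⟨ cong (q ℕ.+_) (ℕₚ.+-identityʳ q) ⟩
      q ℕ.+ q                                                       ∎))
      where
      open ℕₚ.≤-Reasoning
      q<q+1 : q ℕ.< q ℕ.+ 1
      q<q+1 = ℕₚ.m<m+n q (s≤s z≤n)
      unrepresentable : ∀ x y → x * x + y * y ≢ r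
      unrepresentable x y x*x+y*y≡r = ℕₚ.1+n≢0 (ℕₚ.n≤0⇒n≡0 (begin
        1                               ≡⟨ 𝟙-yes (‖ (x , y) ‖² ≟ r) x*x+y*y≡r ⟨
        𝟙 (‖ (x , y) ‖² ≟ r)            ≤⟨ Points.f≤∑f (λ p → 𝟙 (‖ p ‖² ≟ r)) (x , y) ⟩
        ∑[ p ∈ points ] 𝟙 (‖ p ‖² ≟ r)  ≡⟨ ∑≡0 ⟩
        0                               ∎))

  q%4≡3⇒1+1≢0 : q % 4 ≡ 3 → 1# + 1# ≢ 0#
  q%4≡3⇒1+1≢0 q%4≡3 = Arithmetic.m%4≡3⇒2∤m q%4≡3 ∘ 1+1≡0⇒2∣q

  q%4≡3⇒x*x+1≢0 : q % 4 ≡ 3 → ∀ x → x * x + 1# ≢ 0#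
  q%4≡3⇒x*x+1≢0 q%4≡3 x x*x+1≡0
    with () ← trans (sym q%4≡3) (OddCharacteristic.i*i+1≡0⇒q%4≡1 (q%4≡3⇒1+1≢0 q%4≡3) x*x+1≡0)

  x-ᵖy≡0⇒x≡y : ∀ {x y} → x -ᵖ y ≡ (0# , 0#) → x ≡ y
  x-ᵖy≡0⇒x≡y {_ , _} {_ , _} eq = cong₂ _,_ (x-y≡0⇒x≡y (,-injectiveˡ eq)) (x-y≡0⇒x≡y (,-injectiveʳ eq))

  x-ᵖz≡y-ᵖz⇒x≡y : ∀ {x y z} → x -ᵖ z ≡ y -ᵖ z → x ≡ y
  x-ᵖz≡y-ᵖz⇒x≡y {_ , _} {_ , _} {z₁ , z₂} eq =
    cong₂ _,_ (+-cancelʳ (- z₁) _ _ (,-injectiveˡ eq)) (+-cancelʳ (- z₂) _ _ (,-injectiveʳ eq))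

  x-ᵖu≡y-ᵖv⇒x-ᵖy≡u-ᵖv : ∀ {x y u v} → x -ᵖ u ≡ y -ᵖ v → x -ᵖ y ≡ u -ᵖ v
  x-ᵖu≡y-ᵖv⇒x-ᵖy≡u-ᵖv {_ , _} {_ , _} {_ , _} {_ , _} eq =
    cong₂ _,_ (x-u≡y-v⇒x-y≡u-v (,-injectiveˡ eq)) (x-u≡y-v⇒x-y≡u-v (,-injectiveʳ eq))

  -- Multiplication in F_q[i]/(i² + 1), reading (x₁ , x₂) as x₁ + x₂ i; ‖_‖² is its norm.
  infixl 7 _⊗_
  _⊗_ : Point → Point → Point
  (x₁ , x₂) ⊗ (y₁ , y₂) = (x₁ * y₁ - x₂ * y₂ , x₁ * y₂ + x₂ * y₁)

  conj : Point → Point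
  conj (x₁ , x₂) = (x₁ , - x₂)

  ‖⊗‖² : ∀ z w → ‖ z ⊗ w ‖² ≡ ‖ z ‖² * ‖ w ‖²
  ‖⊗‖² (a , b) (c , d) = solve 4 (λ a b c d →
    (a :* c :- b :* d) :* (a :* c :- b :* d) :+ (a :* d :+ b :* c) :* (a :* d :+ b :* c) :=
    (a :* a :+ b :* b) :* (c :* c :+ d :* d)) refl a b c d

  ⊗-comm : ∀ z w → z ⊗ w ≡ w ⊗ z
  ⊗-comm (a , b) (c , d) =
    cong₂ _,_ (solve 4 (λ a b c d → a :* c :- b :* d := c :* a :- d :* b) refl a b c d)
              (solve 4 (λ a b c d → a :* d :+ b :* c := c :* b :+ d :* a) refl a b c d)

  ⊗-distribˡ--ᵖ : ∀ w c d → w ⊗ c -ᵖ w ⊗ d ≡ w ⊗ (c -ᵖ d)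
  ⊗-distribˡ--ᵖ (w₁ , w₂) (c₁ , c₂) (d₁ , d₂) = cong₂ _,_
    (solve 6 (λ w₁ w₂ c₁ c₂ d₁ d₂ → (w₁ :* c₁ :- w₂ :* c₂) :- (w₁ :* d₁ :- w₂ :* d₂) :=
                                    w₁ :* (c₁ :- d₁) :- w₂ :* (c₂ :- d₂)) refl w₁ w₂ c₁ c₂ d₁ d₂)
    (solve 6 (λ w₁ w₂ c₁ c₂ d₁ d₂ → (w₁ :* c₂ :+ w₂ :* c₁) :- (w₁ :* d₂ :+ w₂ :* d₁) :=
                                    w₁ :* (c₂ :- d₂) :+ w₂ :* (c₁ :- d₁)) refl w₁ w₂ c₁ c₂ d₁ d₂)

  w⊗z⊗conj[z] : ∀ w z → w ⊗ z ⊗ conj z ≡ (‖ z ‖² * proj₁ w , ‖ z ‖² * proj₂ w)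
  w⊗z⊗conj[z] (w₁ , w₂) (z₁ , z₂) = cong₂ _,_
    (solve 4 (λ w₁ w₂ z₁ z₂ → (w₁ :* z₁ :- w₂ :* z₂) :* z₁ :- (w₁ :* z₂ :+ w₂ :* z₁) :* (:- z₂) :=
                              (z₁ :* z₁ :+ z₂ :* z₂) :* w₁) refl w₁ w₂ z₁ z₂)
    (solve 4 (λ w₁ w₂ z₁ z₂ → (w₁ :* z₁ :- w₂ :* z₂) :* (:- z₂) :+ (w₁ :* z₂ :+ w₂ :* z₁) :* z₁ :=
                              (z₁ :* z₁ :+ z₂ :* z₂) :* w₂) refl w₁ w₂ z₁ z₂)

  ⊗-cancelʳ : ∀ {z w w′} → ‖ z ‖² ≢ 0# → w ⊗ z ≡ w′ ⊗ z → w ≡ w′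
  ⊗-cancelʳ {z} {w₁ , w₂} {w₁′ , w₂′} ‖z‖²≢0 eq =
    cong₂ _,_ (*-cancelˡ ‖z‖²≢0 (,-injectiveˡ scaled)) (*-cancelˡ ‖z‖²≢0 (,-injectiveʳ scaled))
    where
    scaled : (‖ z ‖² * w₁ , ‖ z ‖² * w₂) ≡ (‖ z ‖² * w₁′ , ‖ z ‖² * w₂′)
    scaled = trans (sym (w⊗z⊗conj[z] (w₁ , w₂) z)) (trans (cong (_⊗ conj z) eq) (w⊗z⊗conj[z] (w₁′ , w₂′) z))

  ‖z‖²≡0⇒z≡0 : (∀ x → x * x + 1# ≢ 0#) → ∀ z → ‖ z ‖² ≡ 0# → z ≡ (0# , 0#)
  ‖z‖²≡0⇒z≡0 x*x+1≢0 (x , y) x*x+y*y≡0 with y ≟ 0#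
  ... | yes refl = cong (_, 0#) (x*x≡0⇒x≡0 (begin
    x * x                ≡⟨ +-identityʳ (x * x) ⟨
    x * x + 0#           ≡⟨ cong (x * x +_) (zeroʳ 0#) ⟨
    x * x + 0# * 0#      ≡⟨ x*x+y*y≡0 ⟩
    0#                   ∎))
    where open ≡-Reasoning
  ... | no y≢0 = ⊥-elim (x*x+1≢0 (x * y ⁻¹) (begin
    (x * y ⁻¹) * (x * y ⁻¹) + 1#                       ≡⟨ cong ((x * y ⁻¹) * (x * y ⁻¹) +_) y*y⁻¹*[y*y⁻¹]≡1 ⟨
    (x * y ⁻¹) * (x * y ⁻¹) + (y * y ⁻¹) * (y * y ⁻¹)  ≡⟨ solve 3 (λ x y y⁻¹ →
                                                            (x :* y⁻¹) :* (x :* y⁻¹) :+ (y :* y⁻¹) :* (y :* y⁻¹) :=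
                                                            (x :* x :+ y :* y) :* (y⁻¹ :* y⁻¹)) refl x y (y ⁻¹) ⟩
    (x * x + y * y) * (y ⁻¹ * y ⁻¹)                    ≡⟨ cong (_* (y ⁻¹ * y ⁻¹)) x*x+y*y≡0 ⟩
    0# * (y ⁻¹ * y ⁻¹)                                 ≡⟨ zeroˡ _ ⟩
    0#                                                 ∎))
    where
    open ≡-Reasoning
    y*y⁻¹*[y*y⁻¹]≡1 : (y * y ⁻¹) * (y * y ⁻¹) ≡ 1#
    y*y⁻¹*[y*y⁻¹]≡1 = trans (cong₂ _*_ (inverse y y≢0) (inverse y y≢0)) (*-identityˡ 1#)

  -- The rational parametrisation of the unit circle from (−1 , 0); slope is its inverse.
  module UnitCircle (1+1≢0 : 1# + 1# ≢ 0#) (x*x+1≢0 : ∀ x → x * x + 1# ≢ 0#) where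

    circle : Carrier → Point
    circle l = ((1# - l * l) / (1# + l * l) , (l + l) / (1# + l * l))

    slope : Point → Carrier
    slope (x , y) = y / (1# + x)

    1+l*l≢0 : ∀ l → 1# + l * l ≢ 0#
    1+l*l≢0 l eq = x*x+1≢0 l (trans (+-comm (l * l) 1#) eq)

    ‖circle‖²≡1 : ∀ l → ‖ circle l ‖² ≡ 1#
    ‖circle‖²≡1 l = begin
      ((1# - l * l) * e) * ((1# - l * l) * e) + ((l + l) * e) * ((l + l) * e)
        ≡⟨ solve 2 (λ l e → ((:1 :- l :* l) :* e) :* ((:1 :- l :* l) :* e) :+ ((l :+ l) :* e) :* ((l :+ l) :* e) :=
                            ((:1 :+ l :* l) :* e) :* ((:1 :+ l :* l) :* e)) refl l e ⟩
      ((1# + l * l) * e) * ((1# + l * l) * e)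
        ≡⟨ cong₂ _*_ (inverse _ (1+l*l≢0 l)) (inverse _ (1+l*l≢0 l)) ⟩
      1# * 1#
        ≡⟨ *-identityˡ 1# ⟩
      1#
        ∎
      where
      open ≡-Reasoning
      e : Carrier
      e = (1# + l * l) ⁻¹

    slope∘circle : ∀ l → slope (circle l) ≡ l
    slope∘circle l = begin
      ((l + l) * e) / (1# + (1# - l * l) * e)  ≡⟨ cong₂ _/_ numerator denominator ⟩
      (l * ((1# + 1#) * e)) / ((1# + 1#) * e)  ≡⟨ x*y/y≡x l (x≢0⇒y≢0⇒x*y≢0 1+1≢0 (x≢0⇒x⁻¹≢0 (1+l*l≢0 l))) ⟩
      l                                        ∎
      where
      open ≡-Reasoning
      e : Carrier
      e = (1# + l * l) ⁻¹
      numerator : (l + l) * e ≡ l * ((1# + 1#) * e)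
      numerator = solve 2 (λ l e → (l :+ l) :* e := l :* ((:1 :+ :1) :* e)) refl l e
      denominator : 1# + (1# - l * l) * e ≡ (1# + 1#) * e
      denominator = begin
        1# + (1# - l * l) * e                ≡⟨ cong (_+ (1# - l * l) * e) (inverse _ (1+l*l≢0 l)) ⟨
        (1# + l * l) * e + (1# - l * l) * e  ≡⟨ solve 2 (λ l e → (:1 :+ l :* l) :* e :+ (:1 :- l :* l) :* e :=
                                                                 (:1 :+ :1) :* e) refl l e ⟩
        (1# + 1#) * e                        ∎

    circle-injective : ∀ {l m} → circle l ≡ circle m → l ≡ m
    circle-injective {l} {m} eq = trans (sym (slope∘circle l)) (trans (cong slope eq) (slope∘circle m))

  module Counting (1+1≢0 : 1# + 1# ≢ 0#) (x*x+1≢0 : ∀ x → x * x + 1# ≢ 0#)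
                  (E : Point → Bool) (r : Carrier) (r≢0 : r ≢ 0#) where

    open OddCharacteristic 1+1≢0 using (sum-of-two-squares)
    open UnitCircle 1+1≢0 x*x+1≢0 using (circle; ‖circle‖²≡1; circle-injective)

    s : Point
    s = proj₁ (sum-of-two-squares r)

    ‖s‖²≡r : ‖ s ‖² ≡ r
    ‖s‖²≡r = proj₂ (sum-of-two-squares r)

    W : Carrier → Point
    W l = s ⊗ circle l

    ‖W‖²≡r : ∀ l → ‖ W l ‖² ≡ r
    ‖W‖²≡r l = trans (‖⊗‖² s (circle l)) (trans (cong₂ _*_ ‖s‖²≡r (‖circle‖²≡1 l)) (*-identityʳ r))

    W-injective : ∀ {l m} → W l ≡ W m → l ≡ m
    W-injective {l} {m} eq =
      circle-injective (⊗-cancelʳ ‖s‖²≢0 (trans (⊗-comm (circle l) s) (trans eq (⊗-comm s (circle m)))))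
      where
      ‖s‖²≢0 : ‖ s ‖² ≢ 0#
      ‖s‖²≢0 ‖s‖²≡0 = r≢0 (trans (sym ‖s‖²≡r) ‖s‖²≡0)

    L : List Point
    L = pointsOf E

    n n² : ℕ
    n = card E
    n² = n ℕ.* n

    -- A pair p = (a , c) stands for the first and third entries of a quadruple (a , b , c , d).
    pairs : List (Point × Point)
    pairs = cartesianProduct L L

    _≟²_ : DecidableEquality (Point × Point)
    _≟²_ = ≡-dec _≟ᵖ_ _≟ᵖ_

    shift : Point → Point × Point → Point
    shift w (a , c) = a -ᵖ w ⊗ c

    collisions : Point → ℕ
    collisions w = ∑[ p ∈ pairs ] ∑[ p′ ∈ pairs ] 𝟙 (shift w p ≟ᵖ shift w p′)

    HasRatio : Point × Point → Point × Point → Set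
    HasRatio (a , c) (b , d) = ‖ c -ᵖ d ‖² ≢ 0# × ‖ a -ᵖ b ‖² / ‖ c -ᵖ d ‖² ≡ r

    hasRatio? : ∀ p p′ → Dec (HasRatio p p′)
    hasRatio? (a , c) (b , d) = ¬? (‖ c -ᵖ d ‖² ≟ 0#) ×-dec (‖ a -ᵖ b ‖² / ‖ c -ᵖ d ‖² ≟ r)

    ProperCollision : Point → Point × Point → Point × Point → Set
    ProperCollision w (a , c) (b , d) = ‖ c -ᵖ d ‖² ≢ 0# × shift w (a , c) ≡ shift w (b , d)

    properCollision? : ∀ w p p′ → Dec (ProperCollision w p p′)
    properCollision? w (a , c) (b , d) = ¬? (‖ c -ᵖ d ‖² ≟ 0#) ×-dec (shift w (a , c) ≟ᵖ shift w (b , d))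

    properCollisions : Point → ℕ
    properCollisions w = ∑[ p ∈ pairs ] ∑[ p′ ∈ pairs ] 𝟙 (properCollision? w p p′)

    ∑-quadruples : ∀ (f : Point × Point × Point × Point → ℕ) →
                   ∑ (quadruples E) f ≡ ∑[ a ∈ L ] ∑[ b ∈ L ] ∑[ c ∈ L ] ∑[ d ∈ L ] f (a , b , c , d)
    ∑-quadruples f = trans (∑-concatMap _ L f) (∑-cong L (λ a → trans (∑-concatMap _ L f) (∑-cong L (λ b →
                       trans (∑-concatMap _ L f) (∑-cong L (λ c → ∑-map _ L f))))))

    ∑-pairs² : ∀ (f : Point × Point → Point × Point → ℕ) →
               ∑[ p ∈ pairs ] ∑[ p′ ∈ pairs ] f p p′ ≡
               ∑[ a ∈ L ] ∑[ c ∈ L ] ∑[ b ∈ L ] ∑[ d ∈ L ] f (a , c) (b , d)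
    ∑-pairs² f = trans (∑-cartesianProduct L L _) (∑-cong L (λ a → ∑-cong L (λ c → ∑-cartesianProduct L L _)))

    V≡∑hasRatio : V E r ≡ ∑[ p ∈ pairs ] ∑[ p′ ∈ pairs ] 𝟙 (hasRatio? p p′)
    V≡∑hasRatio = begin
      V E r
        ≡⟨ trans (length-filter≡∑𝟙 _ (quadruples E)) (∑-quadruples _) ⟩
      ∑[ a ∈ L ] ∑[ b ∈ L ] ∑[ c ∈ L ] ∑[ d ∈ L ] 𝟙 (hasRatio? (a , c) (b , d))
        ≡⟨ ∑-cong L (λ a → ∑-comm L L _) ⟩
      ∑[ a ∈ L ] ∑[ c ∈ L ] ∑[ b ∈ L ] ∑[ d ∈ L ] 𝟙 (hasRatio? (a , c) (b , d))
        ≡⟨ ∑-pairs² (λ p p′ → 𝟙 (hasRatio? p p′)) ⟨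
      ∑[ p ∈ pairs ] ∑[ p′ ∈ pairs ] 𝟙 (hasRatio? p p′)
        ∎
      where open ≡-Reasoning

    length-pairs : length pairs ≡ n²
    length-pairs = length-cartesianProduct L L

    multiplicity-pairs≤1 : ∀ p → multiplicity _≟²_ pairs p ℕ.≤ 1
    multiplicity-pairs≤1 (a , c) = begin
      multiplicity _≟²_ pairs (a , c)                  ≡⟨ multiplicity-cartesianProduct _≟ᵖ_ _≟ᵖ_ L L a c ⟩
      multiplicity _≟ᵖ_ L a ℕ.* multiplicity _≟ᵖ_ L c  ≤⟨ ℕₚ.*-mono-≤ (multiplicity-L≤1 a) (multiplicity-L≤1 c) ⟩
      1                                                ∎
      where
      open ℕₚ.≤-Reasoning
      multiplicity-L≤1 : ∀ x → multiplicity _≟ᵖ_ L x ℕ.≤ 1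
      multiplicity-L≤1 x = ℕₚ.≤-trans (multiplicity-filter-≤ _≟ᵖ_ (λ y → E y Bool.≟ true) points x)
                                      (ℕₚ.≤-reflexive (points-isEnumeration x))

    collisions-lower-bound : ∀ w → n² ℕ.* n² ℕ.≤ (q ℕ.* q) ℕ.* collisions w
    collisions-lower-bound w = subst₂ (λ k m → k ℕ.* k ℕ.≤ m ℕ.* collisions w) length-pairs length-points
      (Points.cauchy-schwarz-collisions (shift w) pairs)

    collision⇒proper∨diagonal : ∀ w p p′ →
      𝟙 (shift w p ≟ᵖ shift w p′) ℕ.≤ 𝟙 (properCollision? w p p′) ℕ.+ 𝟙 (p ≟² p′)
    collision⇒proper∨diagonal w (a , c) (b , d) with shift w (a , c) ≟ᵖ shift w (b , d)
    ... | no _ = z≤n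
    ... | yes collide with ‖ c -ᵖ d ‖² ≟ 0#
    ...   | no _ = s≤s z≤n
    ...   | yes ‖c-d‖²≡0 = ℕₚ.≤-reflexive (sym (𝟙-yes ((a , c) ≟² (b , d)) (cong₂ _,_ a≡b c≡d)))
      where
      c≡d : c ≡ d
      c≡d = x-ᵖy≡0⇒x≡y (‖z‖²≡0⇒z≡0 x*x+1≢0 (c -ᵖ d) ‖c-d‖²≡0)
      a≡b : a ≡ b
      a≡b = x-ᵖz≡y-ᵖz⇒x≡y (trans collide (cong (λ t → b -ᵖ w ⊗ t) (sym c≡d)))

    diagonal-bound : ∑[ p ∈ pairs ] ∑[ p′ ∈ pairs ] 𝟙 (p ≟² p′) ℕ.≤ n²
    diagonal-bound = begin
      ∑[ p ∈ pairs ] multiplicity _≟²_ pairs p  ≤⟨ ∑-mono-≤ pairs multiplicity-pairs≤1 ⟩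
      ∑ pairs (const 1)                         ≡⟨ length≡∑1 pairs ⟨
      length pairs                              ≡⟨ length-pairs ⟩
      n²                                        ∎
      where open ℕₚ.≤-Reasoning

    collisions-upper-bound : ∀ w → collisions w ℕ.≤ properCollisions w ℕ.+ n²
    collisions-upper-bound w = begin
      collisions w
        ≤⟨ ∑-mono-≤ pairs (λ p → ∑-mono-≤ pairs (collision⇒proper∨diagonal w p)) ⟩
      ∑[ p ∈ pairs ] ∑[ p′ ∈ pairs ] (𝟙 (properCollision? w p p′) ℕ.+ 𝟙 (p ≟² p′))
        ≡⟨ trans (∑-cong pairs (λ p → ∑-distrib-+ pairs _ _)) (∑-distrib-+ pairs _ _) ⟩
      properCollisions w ℕ.+ (∑[ p ∈ pairs ] ∑[ p′ ∈ pairs ] 𝟙 (p ≟² p′))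
        ≤⟨ ℕₚ.+-monoʳ-≤ (properCollisions w) diagonal-bound ⟩
      properCollisions w ℕ.+ n²
        ∎
      where open ℕₚ.≤-Reasoning

    collision⇒difference : ∀ {w a b c d} → shift w (a , c) ≡ shift w (b , d) → a -ᵖ b ≡ w ⊗ (c -ᵖ d)
    collision⇒difference {w} {c = c} {d = d} collide =
      trans (x-ᵖu≡y-ᵖv⇒x-ᵖy≡u-ᵖv collide) (⊗-distribˡ--ᵖ w c d)

    proper⇒hasRatio : ∀ l p p′ → ProperCollision (W l) p p′ → HasRatio p p′
    proper⇒hasRatio l (a , c) (b , d) (‖c-d‖²≢0 , collide) = ‖c-d‖²≢0 , (begin
      ‖ a -ᵖ b ‖² / ‖ c -ᵖ d ‖²               ≡⟨ cong (λ z → ‖ z ‖² / ‖ c -ᵖ d ‖²)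
                                                     (collision⇒difference collide) ⟩
      ‖ W l ⊗ (c -ᵖ d) ‖² / ‖ c -ᵖ d ‖²       ≡⟨ cong (_/ ‖ c -ᵖ d ‖²) (‖⊗‖² (W l) (c -ᵖ d)) ⟩
      (‖ W l ‖² * ‖ c -ᵖ d ‖²) / ‖ c -ᵖ d ‖²  ≡⟨ x*y/y≡x ‖ W l ‖² ‖c-d‖²≢0 ⟩
      ‖ W l ‖²                                ≡⟨ ‖W‖²≡r l ⟩
      r                                       ∎)
      where open ≡-Reasoning

    proper-unique : ∀ p p′ {l m} → ProperCollision (W l) p p′ → ProperCollision (W m) p p′ → l ≡ m
    proper-unique (a , c) (b , d) (‖c-d‖²≢0 , collideˡ) (_ , collideᵐ) = W-injective (⊗-cancelʳ ‖c-d‖²≢0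
      (trans (sym (collision⇒difference collideˡ)) (collision⇒difference collideᵐ)))

    ∑-proper≤hasRatio : ∀ p p′ → ∑[ l ∈ elements ] 𝟙 (properCollision? (W l) p p′) ℕ.≤ 𝟙 (hasRatio? p p′)
    ∑-proper≤hasRatio p p′ with hasRatio? p p′
    ... | yes _ = Elements.∑-𝟙-unique≤1 (λ l → properCollision? (W l) p p′) (proper-unique p p′)
    ... | no ¬ratio = ℕₚ.≤-reflexive (∑-const-0 elements (λ l → 𝟙-no _ (¬ratio ∘ proper⇒hasRatio l p p′)))

    ∑-properCollisions≤V : ∑[ l ∈ elements ] properCollisions (W l) ℕ.≤ V E r
    ∑-properCollisions≤V = begin
      ∑[ l ∈ elements ] ∑[ p ∈ pairs ] ∑[ p′ ∈ pairs ] 𝟙 (properCollision? (W l) p p′)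
        ≡⟨ trans (∑-comm elements pairs _) (∑-cong pairs (λ p → ∑-comm elements pairs _)) ⟩
      ∑[ p ∈ pairs ] ∑[ p′ ∈ pairs ] ∑[ l ∈ elements ] 𝟙 (properCollision? (W l) p p′)
        ≤⟨ ∑-mono-≤ pairs (λ p → ∑-mono-≤ pairs (∑-proper≤hasRatio p)) ⟩
      ∑[ p ∈ pairs ] ∑[ p′ ∈ pairs ] 𝟙 (hasRatio? p p′)
        ≡⟨ V≡∑hasRatio ⟨
      V E r
        ∎
      where open ℕₚ.≤-Reasoning

    main-inequality : q ℕ.* (n² ℕ.* n²) ℕ.≤ (q ℕ.* q) ℕ.* (V E r ℕ.+ q ℕ.* n²)
    main-inequality = begin
      q ℕ.* (n² ℕ.* n²)                                   ≡⟨ cong (ℕ._* (n² ℕ.* n²)) length-elements ⟨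
      length elements ℕ.* (n² ℕ.* n²)                     ≡⟨ ∑-const elements (n² ℕ.* n²) ⟨
      ∑[ l ∈ elements ] n² ℕ.* n²                         ≤⟨ ∑-mono-≤ elements (collisions-lower-bound ∘ W) ⟩
      ∑[ l ∈ elements ] (q ℕ.* q) ℕ.* collisions (W l)    ≡⟨ ∑-distribˡ-* elements (q ℕ.* q) _ ⟩
      (q ℕ.* q) ℕ.* (∑[ l ∈ elements ] collisions (W l))  ≤⟨ ℕₚ.*-monoʳ-≤ (q ℕ.* q) ∑-collisions≤V+q*n² ⟩
      (q ℕ.* q) ℕ.* (V E r ℕ.+ q ℕ.* n²)                  ∎
      where
      open ℕₚ.≤-Reasoning
      ∑-collisions≤V+q*n² : ∑[ l ∈ elements ] collisions (W l) ℕ.≤ V E r ℕ.+ q ℕ.* n²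
      ∑-collisions≤V+q*n² = begin
        ∑[ l ∈ elements ] collisions (W l)
          ≤⟨ ∑-mono-≤ elements (collisions-upper-bound ∘ W) ⟩
        ∑[ l ∈ elements ] (properCollisions (W l) ℕ.+ n²)
          ≡⟨ ∑-distrib-+ elements _ _ ⟩
        (∑[ l ∈ elements ] properCollisions (W l)) ℕ.+ ∑ elements (const n²)
          ≤⟨ ℕₚ.+-mono-≤ ∑-properCollisions≤V
                         (ℕₚ.≤-reflexive (trans (∑-const elements n²) (cong (ℕ._* n²) length-elements))) ⟩
        V E r ℕ.+ q ℕ.* n²
          ∎

open import Data.Nat using (ℕ; _*_; _^_; _%_; _≤_)
open import Data.Bool using (Bool)
open import Relation.Binary.PropositionalEquality using (_≡_; _≢_)
open import Data.Nat.Base using (zero; suc)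

theorem2p1 : (q : ℕ) → IsPrimePower q → q % 4 ≡ 3 →
    (F : FiniteField q) → (E : FiniteField.Point F → Bool) →
    2 * (q * q) ≤ FiniteField.card F E * FiniteField.card F E →
    (r : FiniteField.Carrier F) → r ≢ FiniteField.0# F →
    FiniteField.card F E ^ 4 ≤ 4 * q * FiniteField.V F E r
theorem2p1 zero _ () _ _ _ _ _
theorem2p1 q@(suc _) _ q%4≡3 F E 2q²≤|E|² r r≢0 =
  Arithmetic.n⁴≤4qv q (card E) (V E r) 2q²≤|E|²
    (Counting.main-inequality (q%4≡3⇒1+1≢0 q%4≡3) (q%4≡3⇒x*x+1≢0 q%4≡3) E r r≢0)
  where
  open FiniteField F using (card; V)
  open FiniteFieldProperties F using (q%4≡3⇒1+1≢0; q%4≡3⇒x*x+1≢0; module Counting)
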